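{- Let $k$ be a field and let $\mathcal{H}$ be the $k$-vector space with basis the set of packed words over $X=\{x_i\}_{i\ge 0}$. Equip $\mathcal{H}$ with the product $*$ (shifted concatenation, extended bilinearly), the unit $1_{X^*}$ (the empty word), the coproduct $$\Delta(w)=\sum_{I+J=[1\dots |w|]} pack(w[I])\otimes pack\big(w[J]/w[I]\big)\qquad (w \text{ a packed word}),$$ extended linearly, where the sum runs over all ordered pairs $(I,J)$ of disjoint subsets (possibly empty) with $I\cup J=[1\dots|w|]$, and the counit $\epsilon$ given on packed words by $\epsilon(1_{X^*})=1$ and $\epsilon(w)=0$ for $w\neq 1_{X^*}$. Then $(\mathcal{H},*,1_{X^*},\Delta,\epsilon)$ is a Hopf algebra.
   Context: $X=\{x_i\}_{i\ge 0}$ is an alphabet totally ordered by index, and $X^*$ is the free monoid of words over $X$, with empty word $1_{X^*}$. For a word $w$, $|w|$ is its length and $w[i]$ its $i$-th letter. $IAlph(w)=\{i\in\mathbb N: x_i\text{ occurs in }w\}$, $Alph(w)=\{x_i : i\in IAlph(w)\}$, and $sup(w)$ is the supremum of $IAlph(w)$ in $\mathbb N$ (so $sup(1_{X^*})=0$). For a map $\phi$ defined on $IAlph(w)$ with values in $\mathbb N$ and $\phi(0)=0$, the substitution is $S_\phi(x_{i_1}\cdots x_{i_m})=x_{\phi(i_1)}\cdots x_{\phi(i_m)}$. If $IAlph(w)\setminus\{0\}=\{j_1<\dots<j_k\}$, define $\phi_w(j_m)=m$ and $\phi_w(0)=0$; then $pack(w)=S_{\phi_w}(w)$, and $w$ is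 packed if $pack(w)=w$. For $t\in\mathbb N$, $T_t(w)=S_\phi(w)$ where $\phi(n)=n+t$ for $n>0$ and $\phi(0)=0$. The shifted concatenation is $u*v=u\,T_{sup(u)}(v)$ (the concatenation of $u$ with $T_{sup(u)}(v)$). For $I=\{i_1<\dots<i_l\}\subseteq[1\dots|w|]$, the subword is $w[I]=w[i_1]\cdots w[i_l]$. For $A\subseteq X$, $w/A=S_{\phi_A}(w)$ where $\phi_A(i)=0$ if $x_i\in A$ and $\phi_A(i)=i$ otherwise; for words $w,u$, $w/u$ denotes $w/Alph(u)$ (i.e. every letter of $w$ that occurs in $u$ is replaced by $x_0$). -}

module Defs where

open import Level using (Level; _⊔_) renaming (suc to lsuc)
open import Data.Bool using (Bool; true; false; not; if_then_else_)
open import Data.Nat as ℕ using (ℕ; zero; suc; _≟_; _≤?_)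
  renaming (_⊔_ to _⊔ℕ_; _+_ to _+ℕ_)
open import Data.List using (List; []; _∷_; _++_; map; concatMap; filter;
  length; deduplicate; foldr)
open import Data.List.Properties using (≡-dec)
open import Data.List.Membership.DecPropositional _≟_ using (_∈?_)
open import Data.Product using (Σ; ∃; _×_; _,_; proj₁; proj₂)
import Data.Product.Properties as ×P
open import Relation.Nullary using (¬_; Dec; yes; no; does)
open import Relation.Binary using (DecidableEquality)
open import Relation.Binary.PropositionalEquality using (_≡_)
open import Algebra.Bundles using (CommutativeRing)
open import Data.List.Relation.Unary.All using (All)

-- Words over X = {x_i}; the letter x_i is represented by the index i.

Word : Set
Word = List ℕ

_≟W_ : DecidableEquality Word
_≟W_ = ≡-dec _≟_

sup : Word → ℕ
sup = foldr _⊔ℕ_ 0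

T : ℕ → Word → Word
T t = map (λ { zero → zero ; (suc n) → suc n +ℕ t })

_✶_ : Word → Word → Word
u ✶ v = u ++ T (sup u) v

nzAlph : Word → List ℕ
nzAlph w = deduplicate _≟_ (filter (λ n → Relation.Nullary.¬? (n ≟ 0)) w)

-- φ_w(j) = number of distinct nonzero letters of w that are ≤ j
-- (for j ∈ IAlph(w) \ {0} this is its rank m in j_1 < ... < j_k)
φ : Word → ℕ → ℕ
φ w zero    = zero
φ w (suc n) = length (filter (λ j → j ≤? suc n) (nzAlph w))

pack : Word → Word
pack w = map (φ w) w

IsPacked : Word → Set
IsPacked w = pack w ≡ w

-- Subsets I ⊆ [1..n] as Boolean masks of length n (true = position in I);
-- J is the complement, so masks enumerate the ordered pairs (I,J), I+J=[1..n].
masks : ℕ → List (List Bool)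
masks zero    = [] ∷ []
masks (suc n) = concatMap (λ m → (true ∷ m) ∷ (false ∷ m) ∷ []) (masks n)

select : List Bool → Word → Word
select []          _       = []
select (_ ∷ _)     []      = []
select (true ∷ m)  (x ∷ w) = x ∷ select m w
select (false ∷ m) (x ∷ w) = select m w

_/W_ : Word → Word → Word
w /W u = map (λ n → if does (n ∈? u) then 0 else n) w

record Field (c ℓ : Level) : Set (lsuc (c ⊔ ℓ)) where
  field
    commutativeRing : CommutativeRing c ℓ
  open CommutativeRing commutativeRing public
  field
    0≉1     : ¬ (0# ≈ 1#)
    inverse : ∀ x → ¬ (x ≈ 0#) → ∃ λ y → (x * y) ≈ 1#

-- Free k-modules as formal finite linear combinations, up to equality of
-- all coefficients.

module Hopf {c ℓ : Level} (K : Field c ℓ) where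
  open Field K

  Lin : Set → Set c
  Lin B = List (Carrier × B)

  coeff : {B : Set} → DecidableEquality B → Lin B → B → Carrier
  coeff _≟B_ []             b = 0#
  coeff _≟B_ ((a , b') ∷ x) b =
    (if does (b' ≟B b) then a else 0#) + coeff _≟B_ x b

  LinEq : {B : Set} → DecidableEquality B → Lin B → Lin B → Set ℓ
  LinEq _≟B_ x y = ∀ b → coeff _≟B_ x b ≈ coeff _≟B_ y b

  _≟2_ : DecidableEquality (Word × Word)
  _≟2_ = ×P.≡-dec _≟W_ _≟W_

  _≟3_ : DecidableEquality (Word × (Word × Word))
  _≟3_ = ×P.≡-dec _≟W_ _≟2_

  _≈H_ : Lin Word → Lin Word → Set ℓ
  _≈H_ = LinEq _≟W_

  _≈H⊗H_ : Lin (Word × Word) → Lin (Word × Word) → Set ℓ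
  _≈H⊗H_ = LinEq _≟2_

  _≈H⊗H⊗H_ : Lin (Word × (Word × Word)) → Lin (Word × (Word × Word)) → Set ℓ
  _≈H⊗H⊗H_ = LinEq _≟3_

  ⟦_⟧ : {B : Set} → B → Lin B
  ⟦ b ⟧ = (1# , b) ∷ []

  _·_ : {B : Set} → Carrier → Lin B → Lin B
  a · x = map (λ p → (a * proj₁ p , proj₂ p)) x

  linExt : {A B : Set} → (A → Lin B) → Lin A → Lin B
  linExt f x = concatMap (λ p → proj₁ p · f (proj₂ p)) x

  mul : Lin Word → Lin Word → Lin Word
  mul x y = linExt (λ u → linExt (λ v → ⟦ u ✶ v ⟧) y) x

  mul⊗ : Lin (Word × Word) → Lin (Word × Word) → Lin (Word × Word)
  mul⊗ x y = linExt (λ p → linExt (λ q →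
    ⟦ (proj₁ p ✶ proj₁ q) , (proj₂ p ✶ proj₂ q) ⟧) y) x

  Δ : Word → Lin (Word × Word)
  Δ w = map (λ m → (1# , (pack (select m w) ,
                           pack (select (map not m) w /W select m w))))
            (masks (length w))

  ε : Word → Carrier
  ε []      = 1#
  ε (_ ∷ _) = 0#

  Δ⊗id : Lin (Word × Word) → Lin (Word × (Word × Word))
  Δ⊗id = linExt (λ p → linExt (λ q → ⟦ proj₁ q , (proj₂ q , proj₂ p) ⟧) (Δ (proj₁ p)))

  id⊗Δ : Lin (Word × Word) → Lin (Word × (Word × Word))
  id⊗Δ = linExt (λ p → linExt (λ q → ⟦ proj₁ p , q ⟧) (Δ (proj₂ p)))

  -- (ε ⊗ id) and (id ⊗ ε), followed by the identification k ⊗ H ≅ H ≅ H ⊗ k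
  ε⊗id : Lin (Word × Word) → Lin Word
  ε⊗id = linExt (λ p → ε (proj₁ p) · ⟦ proj₂ p ⟧)

  id⊗ε : Lin (Word × Word) → Lin Word
  id⊗ε = linExt (λ p → ε (proj₂ p) · ⟦ proj₁ p ⟧)

  εLin : Lin Word → Carrier
  εLin x = foldr (λ p r → proj₁ p * ε (proj₂ p) + r) 0# x

  -- m ∘ (f ⊗ g) applied to an element of H ⊗ H (f, g given on basis words)
  m∘⊗ : (Word → Lin Word) → (Word → Lin Word) → Lin (Word × Word) → Lin Word
  m∘⊗ f g = linExt (λ p → mul (f (proj₁ p)) (g (proj₂ p)))

  InH : Lin Word → Set c
  InH x = All (λ p → IsPacked (proj₂ p)) x

  InH⊗H : Lin (Word × Word) → Set c
  InH⊗H x = All (λ p → IsPacked (proj₁ (proj₂ p)) × IsPacked (proj₂ (proj₂ p))) x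

  -- All structure maps are linear
  -- extensions of their values on the basis of packed words, so every
  -- axiom is required on basis elements (which, by linearity, is equivalent
  -- to the axiom on all of H).
  record IsPackedWordHopfAlgebra : Set (c ⊔ ℓ) where
    field
      unit-packed  : IsPacked []
      mul-closed   : ∀ u v → IsPacked u → IsPacked v → IsPacked (u ✶ v)
      Δ-closed     : ∀ w → IsPacked w → InH⊗H (Δ w)
      mul-assoc    : ∀ u v w → IsPacked u → IsPacked v → IsPacked w →
                     ((u ✶ v) ✶ w) ≡ (u ✶ (v ✶ w))
      mul-unitˡ    : ∀ u → IsPacked u → ([] ✶ u) ≡ u
      mul-unitʳ    : ∀ u → IsPacked u → (u ✶ []) ≡ u
      coassoc      : ∀ w → IsPacked w → Δ⊗id (Δ w) ≈H⊗H⊗H id⊗Δ (Δ w)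
      counitˡ      : ∀ w → IsPacked w → ε⊗id (Δ w) ≈H ⟦ w ⟧
      counitʳ      : ∀ w → IsPacked w → id⊗ε (Δ w) ≈H ⟦ w ⟧
      Δ-mul        : ∀ u v → IsPacked u → IsPacked v →
                     Δ (u ✶ v) ≈H⊗H mul⊗ (Δ u) (Δ v)
      Δ-unit       : Δ [] ≈H⊗H ⟦ [] , [] ⟧
      ε-mul        : ∀ u v → IsPacked u → IsPacked v → ε (u ✶ v) ≈ (ε u * ε v)
      ε-unit       : ε [] ≈ 1#
      antipode     : Σ (Word → Lin Word) λ S →
                       (∀ w → IsPacked w → InH (S w))
                     × (∀ w → IsPacked w → m∘⊗ S ⟦_⟧ (Δ w) ≈H (ε w · ⟦ [] ⟧))
                     × (∀ w → IsPacked w → m∘⊗ ⟦_⟧ S (Δ w) ≈H (ε w · ⟦ [] ⟧))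

module Submission where

-- The packing
-- map φ_u(n) counts the nonzero letters x_j of u with j ≤ n; packing forgets a
-- prior relabelling by φ_u (pack-relabel, pack-relabel-erase) and packs the two
-- blocks of u T_s(v) separately (Blocks.pack-blocks).  Δ(w) is a sum over the
-- list  splits w  of all pairs (w[I], w[J]), and coassociativity and
-- multiplicativity of Δ become rearrangements of lists of terms (termsˡ↭termsʳ,
-- via three-way splittings; terms-✶, via splittings of u ++ v).  Module Linear
-- compares linear combinations through their pairings with all functionals, so
-- that rearrangements give equal sums (module Bialgebra).  In module Antipode a
-- recursion on the length over the terms of Δ(w) yields a left and a right
-- convolution inverse of id; by associativity of convolution they coincide,
-- which gives the antipode.  mainTheorem1 collects these facts.

open import Defs
open import Level using (Level)
import Relation.Binary.PropositionalEquality as P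

module Lists where

  open import Data.List using (List; []; _∷_; _++_; map; concatMap; [_])
  import Data.List.Properties as List
  open import Data.List.Relation.Unary.All using (All; []; _∷_)
  import Data.List.Relation.Unary.All.Properties as All
  open import Data.List.Relation.Binary.Permutation.Propositional
    using (_↭_; prep; swap; ↭-refl; ↭-trans; ↭-reflexive)
    renaming (refl to ↭-base; trans to ↭-compose)
  open import Data.List.Relation.Binary.Permutation.Propositional.Properties
    using (++⁺ˡ; ++⁺; shifts)
  open import Function using (_∘_)
  open import Relation.Binary.PropositionalEquality using (_≡_; refl; sym; trans; cong; cong₂)

  private variable
    a b c : Level
    A : Set a
    B : Set b
    C : Set c

  concatMap⁺ : ∀ (f : A → List B) {xs ys} → xs ↭ ys → concatMap f xs ↭ concatMap f ys
  concatMap⁺ f ↭-base          = ↭-refl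
  concatMap⁺ f (prep x p)      = ++⁺ˡ (f x) (concatMap⁺ f p)
  concatMap⁺ f (swap x y p)    = ↭-trans (shifts (f x) (f y)) (++⁺ˡ (f y) (++⁺ˡ (f x) (concatMap⁺ f p)))
  concatMap⁺ f (↭-compose p q) = ↭-trans (concatMap⁺ f p) (concatMap⁺ f q)

  concatMap-↭ : ∀ {f g : A → List B} xs → (∀ x → f x ↭ g x) → concatMap f xs ↭ concatMap g xs
  concatMap-↭ []       f↭g = ↭-refl
  concatMap-↭ (x ∷ xs) f↭g = ++⁺ (f↭g x) (concatMap-↭ xs f↭g)

  concatMap-++ : ∀ (f g : A → List B) xs →
                 concatMap (λ x → f x ++ g x) xs ↭ concatMap f xs ++ concatMap g xs
  concatMap-++ f g []       = ↭-refl
  concatMap-++ f g (x ∷ xs) = ↭-trans (↭-reflexive (List.++-assoc (f x) (g x) _))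
    (↭-trans (++⁺ˡ (f x) (↭-trans (++⁺ˡ (g x) (concatMap-++ f g xs)) (shifts (g x) (concatMap f xs))))
             (↭-reflexive (sym (List.++-assoc (f x) _ _))))

  concatMap-concatMap : ∀ (f : B → List C) (g : A → List B) xs →
                        concatMap f (concatMap g xs) ≡ concatMap (concatMap f ∘ g) xs
  concatMap-concatMap f g []       = refl
  concatMap-concatMap f g (x ∷ xs) =
    trans (List.concatMap-++ f (g x) _) (cong (concatMap f (g x) ++_) (concatMap-concatMap f g xs))

  map-as-concatMap : ∀ (h : A → B) xs → map h xs ≡ concatMap (λ x → [ h x ]) xs
  map-as-concatMap h []       = refl
  map-as-concatMap h (x ∷ xs) = cong (h x ∷_) (map-as-concatMap h xs)

  All-concatMap : ∀ {P : A → Set} {Q : B → Set} {f : A → List B} {xs} →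
                  (∀ {x} → P x → All Q (f x)) → All P xs → All Q (concatMap f xs)
  All-concatMap h []         = []
  All-concatMap h (px ∷ pxs) = All.++⁺ (h px) (All-concatMap h pxs)

  concatMap-cong-All : ∀ {f g : A → List B} {P : A → Set} {xs} →
                       (∀ {x} → P x → f x ≡ g x) → All P xs → concatMap f xs ≡ concatMap g xs
  concatMap-cong-All h []         = refl
  concatMap-cong-All h (px ∷ pxs) = cong₂ _++_ (h px) (concatMap-cong-All h pxs)

module Words where

  open import Data.Bool using (Bool; true; false; not; if_then_else_; _∨_)
  open import Data.Bool.Properties using (∨-identityʳ; ∨-assoc)
  open import Data.Nat using (ℕ; zero; suc; _+_; _≤_; _<_; _≟_; _≤?_; z≤n; s≤s; _⊔_)
  open import Data.Nat.Properties
  open import Data.List using (List; []; _∷_; _++_; map; filter; length; concatMap; [_])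
  import Data.List.Properties as List
  open import Data.List.Relation.Unary.All using (All; []; _∷_; tabulate)
  import Data.List.Relation.Unary.All as All
  open import Data.List.Relation.Unary.All.Properties using (All¬⇒¬Any)
  import Data.List.Relation.Unary.All.Properties as All
  open import Data.List.Membership.Propositional using (_∈_; _∉_)
  open import Data.List.Membership.DecPropositional _≟_ using (_∈?_)
  open import Data.List.Membership.Propositional.Properties
    using (∈-map⁺; ∈-map⁻; ∈-filter⁺; ∈-filter⁻; ∈-deduplicate⁺; ∈-deduplicate⁻; ∈-++⁺ˡ; ∈-++⁺ʳ)
  open import Data.List.Relation.Unary.Unique.Propositional using (Unique)
  open import Data.List.Relation.Unary.AllPairs using ([]; _∷_)
  open import Data.List.Relation.Unary.Unique.DecPropositional.Properties using (deduplicate-!)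
  open import Data.Product using (∃; _×_; _,_; proj₁; proj₂)
  open import Data.Empty using (⊥-elim)
  open import Function using (_∘_)
  open import Function.Bundles using (mk⇔)
  open import Relation.Nullary using (Dec; yes; no; does; ¬?)
  open import Relation.Nullary.Decidable using (dec-true; dec-false; does-⇔)
  open import Relation.Binary using (tri<; tri≈; tri>)
  open import Relation.Binary.PropositionalEquality hiding ([_])
  open import Data.List.Relation.Binary.Permutation.Propositional
    using (_↭_; prep; ↭-refl; ↭-trans; ↭-sym; ↭-reflexive; module PermutationReasoning)
  open import Data.List.Relation.Binary.Permutation.Propositional.Properties
    using (∈-resp-↭; ↭-length; shift; map⁺)
  open Lists

  occurs : Word → ℕ → Bool
  occurs w n = does (n ∈? w)

  occurs⁺ : ∀ {w n} → n ∈ w → occurs w n ≡ true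
  occurs⁺ {w} {n} = dec-true (n ∈? w)

  occurs⁻ : ∀ {w n} → occurs w n ≡ true → n ∈ w
  occurs⁻ {w} {n} e with n ∈? w
  ... | yes n∈w = n∈w

  occurs-false : ∀ {w n} → n ∉ w → occurs w n ≡ false
  occurs-false {w} {n} = dec-false (n ∈? w)

  occurs-cong : ∀ {a b m n} → (m ∈ a → n ∈ b) → (n ∈ b → m ∈ a) → occurs a m ≡ occurs b n
  occurs-cong {a} {b} {m} {n} to from = does-⇔ (mk⇔ to from) (m ∈? a) (n ∈? b)

  occurs-++ : ∀ a b n → occurs (a ++ b) n ≡ occurs a n ∨ occurs b n
  occurs-++ []      b n = refl
  occurs-++ (x ∷ a) b n =
    trans (cong (does (n ≟ x) ∨_) (occurs-++ a b n)) (sym (∨-assoc (does (n ≟ x)) _ _))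

  occurs-map⁺ : ∀ (g : ℕ → ℕ) a {y} → occurs a y ≡ true → occurs (map g a) (g y) ≡ true
  occurs-map⁺ g a e = occurs⁺ (∈-map⁺ g (occurs⁻ {a} e))

  occurs-map⁻ : ∀ (g : ℕ → ℕ) a {k} → occurs (map g a) k ≡ true →
                ∃ λ y → occurs a y ≡ true × k ≡ g y
  occurs-map⁻ g a e with ∈-map⁻ g (occurs⁻ {map g a} e)
  ... | y , y∈a , k≡gy = y , occurs⁺ y∈a , k≡gy

  bit : Bool → ℕ
  bit true  = 1
  bit false = 0

  count : (ℕ → Bool) → ℕ → ℕ
  count P zero    = 0
  count P (suc n) = count P n + bit (P (suc n))

  count-cong : ∀ {P Q} n → (∀ j → 1 ≤ j → j ≤ n → P j ≡ Q j) → count P n ≡ count Q n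
  count-cong zero    h = refl
  count-cong (suc n) h = cong₂ _+_ (count-cong n (λ j 1≤j j≤n → h j 1≤j (m≤n⇒m≤1+n j≤n)))
                                   (cong bit (h (suc n) (s≤s z≤n) ≤-refl))

  count-true : ∀ P n → P (suc n) ≡ true → count P (suc n) ≡ suc (count P n)
  count-true P n e rewrite e = +-comm (count P n) 1

  count-false : ∀ P n → P (suc n) ≡ false → count P (suc n) ≡ count P n
  count-false P n e rewrite e = +-identityʳ (count P n)

  count-mono : ∀ P {m n} → m ≤ n → count P m ≤ count P n
  count-mono P {m} {zero}  z≤n = ≤-refl
  count-mono P {m} {suc n} m≤1+n with m ≟ suc n
  ... | yes refl = ≤-refl
  ... | no  m≢1+n = ≤-trans (count-mono P (≤-pred (≤∧≢⇒< m≤1+n m≢1+n))) (m≤m+n _ _)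

  count-strict : ∀ P {m n} → m < n → P n ≡ true → count P m < count P n
  count-strict P {m} {suc n} (s≤s m≤n) e =
    ≤-trans (s≤s (count-mono P m≤n)) (≤-reflexive (sym (count-true P n e)))

  count-positive : ∀ P {n} → P n ≡ true → n ≢ 0 → 0 < count P n
  count-positive P {zero}  e n≢0 = ⊥-elim (n≢0 refl)
  count-positive P {suc n} e n≢0 = count-strict P (s≤s z≤n) e

  count-injective : ∀ P {y z} → P y ≡ true → P z ≡ true → count P y ≡ count P z → y ≡ z
  count-injective P {y} {z} py pz e with <-cmp y z
  ... | tri< y<z _ _ = ⊥-elim (<-irrefl e (count-strict P y<z pz))
  ... | tri≈ _ y≡z _ = y≡z
  ... | tri> _ _ z<y = ⊥-elim (<-irrefl (sym e) (count-strict P z<y py))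

  count-stable : ∀ P {m n} → m ≤ n → (∀ j → m < j → j ≤ n → P j ≡ false) → count P m ≡ count P n
  count-stable P {m} {zero}  z≤n h = refl
  count-stable P {m} {suc n} m≤1+n h with m ≟ suc n
  ... | yes refl = refl
  ... | no  m≢1+n = trans (count-stable P m≤n (λ j m<j j≤n → h j m<j (m≤n⇒m≤1+n j≤n)))
                          (sym (count-false P n (h (suc n) (s≤s m≤n) ≤-refl)))
    where
    m≤n : m ≤ n
    m≤n = ≤-pred (≤∧≢⇒< m≤1+n m≢1+n)

  filter-≤-step : ∀ L n → Unique L →
    length (filter (_≤? suc n) L) ≡ length (filter (_≤? n) L) + bit (occurs L (suc n))
  filter-≤-step []      n []            = refl
  filter-≤-step (x ∷ L) n (x∉L ∷ uniq) with <-cmp x (suc n)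
  ... | tri< x<1+n _ _
    rewrite List.filter-accept (_≤? suc n) {xs = L} (<⇒≤ x<1+n)
          | List.filter-accept (_≤? n) {xs = L} (≤-pred x<1+n)
          | dec-false (suc n ≟ x) (λ e → <-irrefl (sym e) x<1+n)
    = cong suc (filter-≤-step L n uniq)
  ... | tri≈ _ refl _
    rewrite List.filter-accept (_≤? suc n) {xs = L} (≤-refl {suc n})
          | List.filter-reject (_≤? n) {xs = L} (1+n≰n {n})
          | dec-true (suc n ≟ suc n) refl
          | filter-≤-step L n uniq
          | occurs-false {L} (All¬⇒¬Any x∉L)
    = trans (cong suc (+-identityʳ _)) (+-comm 1 _)
  ... | tri> _ _ 1+n<x
    rewrite List.filter-reject (_≤? suc n) {xs = L} (<⇒≱ 1+n<x)
          | List.filter-reject (_≤? n) {xs = L} (<⇒≱ (<-trans (n<1+n n) 1+n<x))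
          | dec-false (suc n ≟ x) (λ e → <-irrefl e 1+n<x)
    = filter-≤-step L n uniq

  filter-≤-count : ∀ L n → Unique L → All (_≢ 0) L →
                   length (filter (_≤? n) L) ≡ count (occurs L) n
  filter-≤-count L zero    _    nz =
    cong length (List.filter-none (_≤? 0) (All.map (λ j≢0 j≤0 → j≢0 (n≤0⇒n≡0 j≤0)) nz))
  filter-≤-count L (suc n) uniq nz =
    trans (filter-≤-step L n uniq) (cong (_+ bit (occurs L (suc n))) (filter-≤-count L n uniq nz))

  nonzero? : ∀ n → Dec (n ≢ 0)
  nonzero? n = ¬? (n ≟ 0)

  nzAlph-occurs : ∀ w j → j ≢ 0 → occurs (nzAlph w) j ≡ occurs w j
  nzAlph-occurs w j j≢0 = occurs-cong {nzAlph w} {w}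
    (proj₁ ∘ ∈-filter⁻ nonzero? ∘ ∈-deduplicate⁻ _≟_ (filter nonzero? w))
    (λ j∈w → ∈-deduplicate⁺ _≟_ (∈-filter⁺ nonzero? j∈w j≢0))

  nzAlph-nonzero : ∀ w → All (_≢ 0) (nzAlph w)
  nzAlph-nonzero w = tabulate (proj₂ ∘ ∈-filter⁻ nonzero? {xs = w} ∘ ∈-deduplicate⁻ _≟_ (filter nonzero? w))

  φ≡count : ∀ w n → φ w n ≡ count (occurs w) n
  φ≡count w zero    = refl
  φ≡count w (suc n) =
    trans (filter-≤-count (nzAlph w) (suc n) (deduplicate-! _≟_ _) (nzAlph-nonzero w))
          (count-cong (suc n) (λ { j (s≤s _) _ → nzAlph-occurs w j (λ ()) }))

  rank : Word → ℕ → ℕ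
  rank u = count (occurs u)

  _⊑_ : Word → Word → Set
  a ⊑ u = ∀ y → occurs a y ≡ true → y ≢ 0 → occurs u y ≡ true

  ⊑-refl : ∀ a → a ⊑ a
  ⊑-refl a y e _ = e

  -- rank u is injective on the letters of u and sends nonzero letters to nonzero
  -- ones, so relabelling a ⊑ u by it does not change which letters occur
  occurs-rank : ∀ a u y → a ⊑ u → occurs u y ≡ true → y ≢ 0 →
                occurs (map (rank u) a) (rank u y) ≡ occurs a y
  occurs-rank a u y a⊑u uy y≢0 =
    occurs-cong {map (rank u) a} {a} (occurs⁻ {a} ∘ back ∘ occurs⁺) (∈-map⁺ (rank u))
    where
    back : occurs (map (rank u) a) (rank u y) ≡ true → occurs a y ≡ true
    back e with occurs-map⁻ (rank u) a e
    ... | z , az , ry≡rz with z ≟ 0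
    ...   | yes refl = ⊥-elim (<-irrefl (sym ry≡rz) (count-positive (occurs u) uy y≢0))
    ...   | no  z≢0  = subst (λ t → occurs a t ≡ true)
                        (count-injective (occurs u) (a⊑u z az z≢0) uy (sym ry≡rz)) az

  rank-relabel : ∀ a u → a ⊑ u → ∀ n → rank (map (rank u) a) (rank u n) ≡ rank a n
  rank-relabel a u a⊑u zero = refl
  rank-relabel a u a⊑u (suc n) with occurs u (suc n) in eu
  ... | false = begin
      rank (map (rank u) a) (rank u n + 0)  ≡⟨ cong (rank (map (rank u) a)) (+-identityʳ (rank u n)) ⟩
      rank (map (rank u) a) (rank u n)      ≡⟨ rank-relabel a u a⊑u n ⟩
      rank a n                              ≡⟨ sym (count-false (occurs a) n a-misses) ⟩
      rank a (suc n)                        ∎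
    where
    open ≡-Reasoning
    a-misses : occurs a (suc n) ≡ false
    a-misses with occurs a (suc n) in ea
    ... | false = refl
    ... | true  = trans (sym (a⊑u (suc n) ea (λ ()))) eu
  ... | true = begin
      rank (map (rank u) a) (rank u n + 1)        ≡⟨ cong (rank (map (rank u) a)) (+-comm (rank u n) 1) ⟩
      rank (map (rank u) a) (suc (rank u n))      ≡⟨ cong₂ _+_ (rank-relabel a u a⊑u n) (cong bit occ) ⟩
      rank a n + bit (occurs a (suc n))           ∎
    where
    open ≡-Reasoning
    occ : occurs (map (rank u) a) (suc (rank u n)) ≡ occurs a (suc n)
    occ = trans (cong (occurs (map (rank u) a)) (sym (count-true (occurs u) n eu)))
                (occurs-rank a u (suc n) a⊑u eu (λ ()))

  rank-map : ∀ u a → map (φ u) a ≡ map (rank u) a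
  rank-map u a = List.map-cong (φ≡count u) a

  pack-relabel : ∀ a u → a ⊑ u → pack (map (φ u) a) ≡ pack a
  pack-relabel a u a⊑u = begin
      map (φ (map (φ u) a)) (map (φ u) a)            ≡⟨ sym (List.map-∘ a) ⟩
      map (λ y → φ (map (φ u) a) (φ u y)) a          ≡⟨ List.map-cong ranks a ⟩
      map (φ a) a                                    ∎
    where
    open ≡-Reasoning
    ranks : ∀ y → φ (map (φ u) a) (φ u y) ≡ φ a y
    ranks y = begin
      φ (map (φ u) a) (φ u y)            ≡⟨ cong₂ φ (rank-map u a) (φ≡count u y) ⟩
      φ (map (rank u) a) (rank u y)      ≡⟨ φ≡count (map (rank u) a) (rank u y) ⟩
      rank (map (rank u) a) (rank u y)   ≡⟨ rank-relabel a u a⊑u y ⟩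
      rank a y                           ≡⟨ sym (φ≡count a y) ⟩
      φ a y                              ∎

  pack-idem : ∀ w → pack (pack w) ≡ pack w
  pack-idem w = pack-relabel w w (⊑-refl w)

  erase : Word → ℕ → ℕ
  erase u n = if occurs u n then 0 else n

  erase-zero : ∀ u → erase u 0 ≡ 0
  erase-zero u with occurs u 0
  ... | true  = refl
  ... | false = refl

  erase-kept : ∀ u {n} → occurs u n ≡ false → erase u n ≡ n
  erase-kept u e rewrite e = refl

  occurs-erase⁻ : ∀ b a y → occurs (b /W a) y ≡ true → y ≢ 0 →
                  occurs b y ≡ true × occurs a y ≡ false
  occurs-erase⁻ b a y e y≢0 with occurs-map⁻ (erase a) b e
  ... | z , bz , y≡ez with occurs a z in az
  ...   | true  = ⊥-elim (y≢0 y≡ez)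
  ...   | false rewrite y≡ez = bz , az

  occurs-erase⁺ : ∀ b a y → occurs b y ≡ true → occurs a y ≡ false → occurs (b /W a) y ≡ true
  occurs-erase⁺ b a y by ay =
    subst (λ t → occurs (b /W a) t ≡ true) (erase-kept a ay) (occurs-map⁺ (erase a) b by)

  occurs-erase : ∀ b a y → occurs a y ≡ false → y ≢ 0 → occurs (b /W a) y ≡ occurs b y
  occurs-erase b a y ay y≢0 with occurs b y in by
  ... | true  = occurs-erase⁺ b a y by ay
  ... | false with occurs (b /W a) y in e
  ...   | false = refl
  ...   | true  = trans (sym (proj₁ (occurs-erase⁻ b a y e y≢0))) by

  ⊑-erase : ∀ b a u → b ⊑ u → (b /W a) ⊑ u
  ⊑-erase b a u b⊑u y e y≢0 = b⊑u y (proj₁ (occurs-erase⁻ b a y e y≢0)) y≢0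

  ⊑-erase-both : ∀ c J I → c ⊑ J → (c /W I) ⊑ (J /W I)
  ⊑-erase-both c J I c⊑J y e y≢0 with occurs-erase⁻ c I y e y≢0
  ... | cy , Iy = occurs-erase⁺ J I y (c⊑J y cy y≢0) Iy

  erase-relabel : ∀ a b u → a ⊑ u → b ⊑ u →
    (map (rank u) b) /W (map (rank u) a) ≡ map (rank u) (b /W a)
  erase-relabel a b u a⊑u b⊑u =
    trans (sym (List.map-∘ b)) (trans (List.map-cong-local (tabulate (pointwise _ ∘ occurs⁺))) (List.map-∘ b))
    where
    pointwise : ∀ y → occurs b y ≡ true → erase (map (rank u) a) (rank u y) ≡ rank u (erase a y)
    pointwise zero    _ rewrite erase-zero a = erase-zero (map (rank u) a)
    pointwise (suc y) e rewrite occurs-rank a u (suc y) a⊑u (b⊑u (suc y) e (λ ())) (λ ())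
      with occurs a (suc y)
    ... | true  = refl
    ... | false = refl

  pack-relabel-erase : ∀ a b u → a ⊑ u → b ⊑ u → pack (map (φ u) b /W map (φ u) a) ≡ pack (b /W a)
  pack-relabel-erase a b u a⊑u b⊑u = begin
    pack (map (φ u) b /W map (φ u) a)        ≡⟨ cong₂ (λ x y → pack (y /W x)) (rank-map u a) (rank-map u b) ⟩
    pack (map (rank u) b /W map (rank u) a)  ≡⟨ cong pack (erase-relabel a b u a⊑u b⊑u) ⟩
    pack (map (rank u) (b /W a))             ≡⟨ cong pack (sym (rank-map u (b /W a))) ⟩
    pack (map (φ u) (b /W a))                ≡⟨ pack-relabel (b /W a) u (⊑-erase b a u b⊑u) ⟩
    pack (b /W a)                            ∎
    where open ≡-Reasoning

  erase-erase : ∀ c a b → (c /W a) /W (b /W a) ≡ c /W (a ++ b)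
  erase-erase c a b = trans (sym (List.map-∘ c)) (List.map-cong pointwise c)
    where
    pointwise : ∀ y → erase (b /W a) (erase a y) ≡ erase (a ++ b) y
    pointwise y rewrite occurs-++ a b y with occurs a y in ay
    ... | true  = erase-zero (b /W a)
    pointwise zero    | false = trans (erase-zero (b /W a)) (sym (erase-zero b))
    pointwise (suc y) | false rewrite occurs-erase b a (suc y) ay (λ ()) = refl

  erase-cong : ∀ c I I' → (∀ n → occurs I n ≡ occurs I' n) → c /W I ≡ c /W I'
  erase-cong c I I' h = List.map-cong (λ n → cong (λ b → if b then 0 else n) (h n)) c

  erase-nothing : ∀ w → w /W [] ≡ w
  erase-nothing = List.map-id

  shiftBy : ℕ → ℕ → ℕ
  shiftBy s zero    = zero
  shiftBy s (suc n) = suc n + s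

  T≡map : ∀ s w → T s w ≡ map (shiftBy s) w
  T≡map s []          = refl
  T≡map s (zero ∷ w)  = cong (zero ∷_) (T≡map s w)
  T≡map s (suc x ∷ w) = cong (suc x + s ∷_) (T≡map s w)

  shiftBy-mono : ∀ s {m n} → m ≤ n → shiftBy s m ≤ shiftBy s n
  shiftBy-mono s {zero}          _   = z≤n
  shiftBy-mono s {suc m} {suc n} m≤n = +-monoˡ-≤ s m≤n

  sup-map : ∀ (h : ℕ → ℕ) → h 0 ≡ 0 → (∀ {m n} → m ≤ n → h m ≤ h n) → ∀ w → sup (map h w) ≡ h (sup w)
  sup-map h h0 mono []      = sym h0
  sup-map h h0 mono (x ∷ w) = trans (cong (h x ⊔_) (sup-map h h0 mono w)) (sym (mono-≤-distrib-⊔ mono x (sup w)))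

  sup-++ : ∀ a b → sup (a ++ b) ≡ sup a ⊔ sup b
  sup-++ []      b = refl
  sup-++ (x ∷ a) b = trans (cong (x ⊔_) (sup-++ a b)) (sym (⊔-assoc x (sup a) (sup b)))

  Bounded : Word → ℕ → Set
  Bounded a s = All (_≤ s) a

  sup-bounded : ∀ w → Bounded w (sup w)
  sup-bounded []      = []
  sup-bounded (x ∷ w) = m≤m⊔n x (sup w) ∷ All.map (λ j≤sup → ≤-trans j≤sup (m≤n⊔m x (sup w))) (sup-bounded w)

  sup-least : ∀ {a s} → Bounded a s → sup a ≤ s
  sup-least []            = z≤n
  sup-least (x≤s ∷ a≤s) = ⊔-lub x≤s (sup-least a≤s)

  above-bound : ∀ {a s j} → Bounded a s → s < j → occurs a j ≡ false
  above-bound {a} a≤s s<j = occurs-false {a} (λ j∈a → <⇒≱ s<j (All.lookup a≤s j∈a))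

  bounded-erase : ∀ {b s} a → Bounded b s → Bounded (b /W a) s
  bounded-erase a b≤s = All.map⁺ (All.map (λ {y} y≤s → ≤-trans (erased≤ y) y≤s) b≤s)
    where
    erased≤ : ∀ y → erase a y ≤ y
    erased≤ y with occurs a y
    ... | true  = z≤n
    ... | false = ≤-refl

  φ-mono : ∀ w {m n} → m ≤ n → φ w m ≤ φ w n
  φ-mono w {m} {n} m≤n = subst₂ _≤_ (sym (φ≡count w m)) (sym (φ≡count w n)) (count-mono (occurs w) m≤n)

  -- ranks stop growing above the letters of a word
  sup-pack : ∀ a s → Bounded a s → sup (pack a) ≡ rank a s
  sup-pack a s a≤s = begin
    sup (map (φ a) a)    ≡⟨ sup-map (φ a) refl (φ-mono a) a ⟩
    φ a (sup a)          ≡⟨ φ≡count a (sup a) ⟩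
    rank a (sup a)       ≡⟨ count-stable (occurs a) (sup-least a≤s) (λ j sup<j _ → above-bound (sup-bounded a) sup<j) ⟩
    rank a s             ∎
    where open ≡-Reasoning

  shifted-low : ∀ s c j → 1 ≤ j → j ≤ s → occurs (map (shiftBy s) c) j ≡ false
  shifted-low s c j 1≤j j≤s = occurs-false {map (shiftBy s) c} absent
    where
    absent : j ∉ map (shiftBy s) c
    absent j∈ with ∈-map⁻ (shiftBy s) j∈
    ... | zero  , _ , refl = <⇒≱ 1≤j z≤n
    ... | suc y , _ , refl = <⇒≱ (s≤s (m≤n+m s y)) j≤s

  shifted-high : ∀ s c n → occurs (map (shiftBy s) c) (suc n + s) ≡ occurs c (suc n)
  shifted-high s c n = occurs-cong {map (shiftBy s) c} {c} back (∈-map⁺ (shiftBy s))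
    where
    back : suc n + s ∈ map (shiftBy s) c → suc n ∈ c
    back n+s∈ with ∈-map⁻ (shiftBy s) n+s∈
    ... | suc y , y∈c , eq rewrite +-cancelʳ-≡ s (suc n) (suc y) eq = y∈c

  -- A word a with letters ≤ s followed by a block c shifted past s: packing and
  -- erasure treat the two blocks independently.
  module Blocks (a c : Word) (s : ℕ) (a≤s : Bounded a s) where

    open ≡-Reasoning

    ac : Word
    ac = a ++ map (shiftBy s) c

    occurs-low : ∀ j → 1 ≤ j → j ≤ s → occurs ac j ≡ occurs a j
    occurs-low j 1≤j j≤s = begin
      occurs ac j                                      ≡⟨ occurs-++ a _ j ⟩
      occurs a j ∨ occurs (map (shiftBy s) c) j        ≡⟨ cong (occurs a j ∨_) (shifted-low s c j 1≤j j≤s) ⟩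
      occurs a j ∨ false                               ≡⟨ ∨-identityʳ _ ⟩
      occurs a j                                       ∎

    occurs-high : ∀ n → occurs ac (suc n + s) ≡ occurs c (suc n)
    occurs-high n = begin
      occurs ac (suc n + s)                                          ≡⟨ occurs-++ a _ _ ⟩
      occurs a (suc n + s) ∨ occurs (map (shiftBy s) c) (suc n + s)  ≡⟨ cong (_∨ _) (above-bound a≤s (s≤s (m≤n+m s n))) ⟩
      occurs (map (shiftBy s) c) (suc n + s)                         ≡⟨ shifted-high s c n ⟩
      occurs c (suc n)                                               ∎

    rank-low : ∀ n → n ≤ s → rank ac n ≡ rank a n
    rank-low n n≤s = count-cong n (λ j 1≤j j≤n → occurs-low j 1≤j (≤-trans j≤n n≤s))

    rank-high : ∀ n → rank ac (n + s) ≡ rank a s + rank c n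
    rank-high zero    = trans (rank-low s ≤-refl) (sym (+-identityʳ _))
    rank-high (suc n) = trans (cong₂ _+_ (rank-high n) (cong bit (occurs-high n)))
                              (+-assoc (rank a s) (rank c n) _)

    pack-blocks : pack (a ++ T s c) ≡ pack a ✶ pack c
    pack-blocks rewrite T≡map s c | T≡map (sup (pack a)) (pack c) | sup-pack a s a≤s =
      trans (List.map-++ (φ ac) a (map (shiftBy s) c)) (cong₂ _++_ first-block second-block)
      where
      first-block : map (φ ac) a ≡ map (φ a) a
      first-block = List.map-cong-local (All.map (λ {y} y≤s →
        trans (φ≡count ac y) (trans (rank-low y y≤s) (sym (φ≡count a y)))) a≤s)
      shifted : ∀ y → occurs c y ≡ true → φ ac (shiftBy s y) ≡ shiftBy (rank a s) (φ c y)
      shifted zero    _ = refl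
      shifted (suc y) e with φ c (suc y) in φy
      ... | zero  = ⊥-elim (<-irrefl (trans (sym φy) (φ≡count c (suc y))) (count-positive (occurs c) e (λ ())))
      ... | suc m = begin
        φ ac (suc y + s)           ≡⟨ φ≡count ac (suc y + s) ⟩
        rank ac (suc y + s)        ≡⟨ rank-high (suc y) ⟩
        rank a s + rank c (suc y)  ≡⟨ cong (rank a s +_) (trans (sym (φ≡count c (suc y))) φy) ⟩
        rank a s + suc m           ≡⟨ +-comm (rank a s) (suc m) ⟩
        suc m + rank a s           ∎
      second-block : map (φ ac) (map (shiftBy s) c) ≡ map (shiftBy (rank a s)) (map (φ c) c)
      second-block = trans (sym (List.map-∘ c))
        (trans (List.map-cong-local (tabulate (shifted _ ∘ occurs⁺))) (List.map-∘ c))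

    erase-blocks : ∀ b d → Bounded b s →
      (b ++ map (shiftBy s) d) /W ac ≡ (b /W a) ++ map (shiftBy s) (d /W c)
    erase-blocks b d b≤s = trans (List.map-++ (erase ac) b _) (cong₂ _++_ first-block second-block)
      where
      low : ∀ {y} → y ≤ s → erase ac y ≡ erase a y
      low {zero}  _   = trans (erase-zero ac) (sym (erase-zero a))
      low {suc y} y≤s rewrite occurs-low (suc y) (s≤s z≤n) y≤s = refl
      first-block : b /W ac ≡ b /W a
      first-block = List.map-cong-local (All.map low b≤s)
      high : ∀ y → erase ac (shiftBy s y) ≡ shiftBy s (erase c y)
      high zero = trans (erase-zero ac) (cong (shiftBy s) (sym (erase-zero c)))
      high (suc y) rewrite occurs-high y with occurs c (suc y)
      ... | true  = refl
      ... | false = refl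
      second-block : map (erase ac) (map (shiftBy s) d) ≡ map (shiftBy s) (d /W c)
      second-block = trans (sym (List.map-∘ d)) (trans (List.map-cong high d) (List.map-∘ d))

  open Blocks using (pack-blocks; erase-blocks)

  ✶-packed : ∀ u v → IsPacked u → IsPacked v → IsPacked (u ✶ v)
  ✶-packed u v pu pv = trans (pack-blocks u v (sup u) (sup-bounded u)) (cong₂ _✶_ pu pv)

  -- shifting by sup(u ✶ v) = sup u ⊔ T_{sup u}(sup v) is shifting twice
  shiftBy-twice : ∀ su sv y → shiftBy (su ⊔ shiftBy su sv) y ≡ shiftBy su (shiftBy sv y)
  shiftBy-twice su zero    zero    = refl
  shiftBy-twice su zero    (suc y) =
    trans (cong (suc y +_) (⊔-identityʳ su)) (cong (λ t → suc t + su) (sym (+-identityʳ y)))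
  shiftBy-twice su (suc m) zero    = refl
  shiftBy-twice su (suc m) (suc y) =
    trans (cong (suc y +_) (m≤n⇒m⊔n≡n (m≤n+m su (suc m)))) (sym (+-assoc (suc y) (suc m) su))

  ✶-assoc : ∀ u v w → (u ✶ v) ✶ w ≡ u ✶ (v ✶ w)
  ✶-assoc u v w
    rewrite T≡map (sup u) v | T≡map (sup v) w | T≡map (sup u) (v ++ map (shiftBy (sup v)) w)
          | T≡map (sup (u ++ map (shiftBy (sup u)) v)) w
          | sup-++ u (map (shiftBy (sup u)) v) | sup-map (shiftBy (sup u)) refl (shiftBy-mono (sup u)) v
    = begin
      (u ++ map (shiftBy su) v) ++ map (shiftBy (su ⊔ shiftBy su sv)) w
        ≡⟨ List.++-assoc u _ _ ⟩
      u ++ map (shiftBy su) v ++ map (shiftBy (su ⊔ shiftBy su sv)) w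
        ≡⟨ cong (λ t → u ++ map (shiftBy su) v ++ t) (trans (List.map-cong (shiftBy-twice su sv) w) (List.map-∘ w)) ⟩
      u ++ map (shiftBy su) v ++ map (shiftBy su) (map (shiftBy sv) w)
        ≡⟨ cong (u ++_) (sym (List.map-++ (shiftBy su) v _)) ⟩
      u ++ map (shiftBy su) (v ++ map (shiftBy sv) w)
        ∎
    where
    open ≡-Reasoning
    su sv : ℕ
    su = sup u
    sv = sup v

  ✶-identityˡ : ∀ u → [] ✶ u ≡ u
  ✶-identityˡ u = trans (T≡map 0 u) (trans (List.map-cong shift0 u) (List.map-id u))
    where
    shift0 : ∀ y → shiftBy 0 y ≡ y
    shift0 zero    = refl
    shift0 (suc y) = +-identityʳ (suc y)

  ✶-identityʳ : ∀ u → u ✶ [] ≡ u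
  ✶-identityʳ = List.++-identityʳ

  -- Splittings.  A pair of words, typically (w[I] , w[J]) for I + J = [1..|w|].
  Split : Set
  Split = Word × Word

  place : ℕ → Split → List Split
  place x (a , b) = (x ∷ a , b) ∷ (a , x ∷ b) ∷ []

  splits : Word → List Split
  splits []      = ([] , []) ∷ []
  splits (x ∷ w) = concatMap (place x) (splits w)

  splits-masks : ∀ w → map (λ m → (select m w , select (map not m) w)) (masks (length w)) ≡ splits w
  splits-masks []      = refl
  splits-masks (x ∷ w) = begin
    map _ (concatMap (λ m → (true ∷ m) ∷ (false ∷ m) ∷ []) (masks (length w)))
      ≡⟨ List.map-concatMap _ _ (masks (length w)) ⟩
    concatMap (place x ∘ (λ m → (select m w , select (map not m) w))) (masks (length w))
      ≡⟨ sym (List.concatMap-map (place x) _ (masks (length w))) ⟩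
    concatMap (place x) (map (λ m → (select m w , select (map not m) w)) (masks (length w)))
      ≡⟨ cong (concatMap (place x)) (splits-masks w) ⟩
    concatMap (place x) (splits w) ∎
    where open ≡-Reasoning

  mapBoth : (ℕ → ℕ) → Split → Split
  mapBoth f (a , b) = (map f a , map f b)

  splits-map : ∀ f w → splits (map f w) ≡ map (mapBoth f) (splits w)
  splits-map f []      = refl
  splits-map f (x ∷ w) = begin
    concatMap (place (f x)) (splits (map f w))         ≡⟨ cong (concatMap (place (f x))) (splits-map f w) ⟩
    concatMap (place (f x)) (map (mapBoth f) (splits w)) ≡⟨ List.concatMap-map (place (f x)) (mapBoth f) (splits w) ⟩
    concatMap (map (mapBoth f) ∘ place x) (splits w)   ≡⟨ sym (List.map-concatMap (mapBoth f) (place x) (splits w)) ⟩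
    map (mapBoth f) (splits (x ∷ w))                   ∎
    where open ≡-Reasoning

  Interleaves : Word → Split → Set
  Interleaves w (a , b) = a ++ b ↭ w

  splits-interleave : ∀ w → All (Interleaves w) (splits w)
  splits-interleave []      = ↭-refl ∷ []
  splits-interleave (x ∷ w) = All-concatMap {f = place x} placed (splits-interleave w)
    where
    placed : ∀ {p} → Interleaves w p → All (Interleaves (x ∷ w)) (place x p)
    placed {a , b} ab↭w = prep x ab↭w ∷ ↭-trans (shift x a b) (prep x ab↭w) ∷ []

  module Interleaving {w a b : Word} (ab↭w : Interleaves w (a , b)) where

    left⊆ : ∀ {y} → y ∈ a → y ∈ w
    left⊆ = ∈-resp-↭ ab↭w ∘ ∈-++⁺ˡ

    right⊆ : ∀ {y} → y ∈ b → y ∈ w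
    right⊆ = ∈-resp-↭ ab↭w ∘ ∈-++⁺ʳ a

    left⊑ : a ⊑ w
    left⊑ y e _ = occurs⁺ (left⊆ (occurs⁻ {a} e))

    right⊑ : b ⊑ w
    right⊑ y e _ = occurs⁺ (right⊆ (occurs⁻ {b} e))

    left-bounded : ∀ {s} → Bounded w s → Bounded a s
    left-bounded w≤s = tabulate (All.lookup w≤s ∘ left⊆)

    right-bounded : ∀ {s} → Bounded w s → Bounded b s
    right-bounded w≤s = tabulate (All.lookup w≤s ∘ right⊆)

    occurs-union : ∀ y → occurs (a ++ b) y ≡ occurs w y
    occurs-union y = occurs-cong {a ++ b} {w} (∈-resp-↭ ab↭w) (∈-resp-↭ (↭-sym ab↭w))

    length-sum : length a + length b ≡ length w
    length-sum = trans (sym (List.length-++ a)) (↭-length ab↭w)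

  _++₂_ : Split → Split → Split
  (a , b) ++₂ (c , d) = (a ++ c , b ++ d)

  splits-++ : ∀ u v → splits (u ++ v) ↭ concatMap (λ p → map (p ++₂_) (splits v)) (splits u)
  splits-++ []      v = ↭-reflexive (sym (trans (List.++-identityʳ _) (List.map-id (splits v))))
  splits-++ (x ∷ u) v = begin
    concatMap (place x) (splits (u ++ v))                ↭⟨ concatMap⁺ (place x) (splits-++ u v) ⟩
    concatMap (place x) (concatMap nextTo (splits u))    ≡⟨ concatMap-concatMap (place x) nextTo (splits u) ⟩
    concatMap (concatMap (place x) ∘ nextTo) (splits u)  ↭⟨ concatMap-↭ (splits u) place-first ⟩
    concatMap (concatMap nextTo ∘ place x) (splits u)    ≡⟨ concatMap-concatMap nextTo (place x) (splits u) ⟨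
    concatMap nextTo (concatMap (place x) (splits u))    ∎
    where
    open PermutationReasoning
    nextTo : Split → List Split
    nextTo p = map (p ++₂_) (splits v)
    -- placing x first in a splitting of u ++ v is placing it in the u-part
    place-first : ∀ p → concatMap (place x) (nextTo p) ↭ concatMap nextTo (place x p)
    place-first (a , b) = begin
      concatMap (place x) (nextTo (a , b))
        ≡⟨ List.concatMap-map (place x) ((a , b) ++₂_) (splits v) ⟩
      concatMap (λ q → [ (x ∷ a , b) ++₂ q ] ++ [ (a , x ∷ b) ++₂ q ]) (splits v)
        ↭⟨ concatMap-++ (λ q → [ (x ∷ a , b) ++₂ q ]) (λ q → [ (a , x ∷ b) ++₂ q ]) (splits v) ⟩
      concatMap (λ q → [ (x ∷ a , b) ++₂ q ]) (splits v) ++ concatMap (λ q → [ (a , x ∷ b) ++₂ q ]) (splits v)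
        ≡⟨ cong₂ _++_ (map-as-concatMap _ (splits v)) (map-as-concatMap _ (splits v)) ⟨
      nextTo (x ∷ a , b) ++ nextTo (a , x ∷ b)
        ≡⟨ cong (nextTo (x ∷ a , b) ++_) (List.++-identityʳ _) ⟨
      concatMap nextTo (place x (a , b)) ∎

  Split₃ : Set
  Split₃ = Word × (Word × Word)

  place₃ : ℕ → Split₃ → List Split₃
  place₃ x (a , (b , c)) = (x ∷ a , (b , c)) ∷ (a , (x ∷ b , c)) ∷ (a , (b , x ∷ c)) ∷ []

  splits₃ : Word → List Split₃
  splits₃ []      = ([] , ([] , [])) ∷ []
  splits₃ (x ∷ w) = concatMap (place₃ x) (splits₃ w)

  extendʳ : Word → Split → Split₃
  extendʳ c (a , b) = (a , (b , c))

  refineˡ refineʳ : Split → List Split₃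
  refineˡ (a , b) = map (extendʳ b) (splits a)
  refineʳ (a , b) = map (a ,_) (splits b)

  refineˡ-splits₃ : ∀ w → concatMap refineˡ (splits w) ↭ splits₃ w
  refineˡ-splits₃ []      = ↭-refl
  refineˡ-splits₃ (x ∷ w) = begin
    concatMap refineˡ (concatMap (place x) (splits w))     ≡⟨ concatMap-concatMap refineˡ (place x) (splits w) ⟩
    concatMap (concatMap refineˡ ∘ place x) (splits w)     ↭⟨ concatMap-↭ (splits w) refine-placed ⟩
    concatMap (concatMap (place₃ x) ∘ refineˡ) (splits w)  ≡⟨ concatMap-concatMap (place₃ x) refineˡ (splits w) ⟨
    concatMap (place₃ x) (concatMap refineˡ (splits w))    ↭⟨ concatMap⁺ (place₃ x) (refineˡ-splits₃ w) ⟩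
    concatMap (place₃ x) (splits₃ w)                       ∎
    where
    open PermutationReasoning
    refine-placed : ∀ p → concatMap refineˡ (place x p) ↭ concatMap (place₃ x) (refineˡ p)
    refine-placed (a , b) = begin
      refineˡ (x ∷ a , b) ++ refineˡ (a , x ∷ b) ++ []
        ≡⟨ cong (refineˡ (x ∷ a , b) ++_) (List.++-identityʳ _) ⟩
      map (extendʳ b) (concatMap (place x) (splits a)) ++ map (extendʳ (x ∷ b)) (splits a)
        ≡⟨ cong₂ _++_ (List.map-concatMap (extendʳ b) (place x) (splits a))
                      (map-as-concatMap (extendʳ (x ∷ b)) (splits a)) ⟩
      concatMap (map (extendʳ b) ∘ place x) (splits a) ++ concatMap (λ q → [ extendʳ (x ∷ b) q ]) (splits a)
        ↭⟨ concatMap-++ (map (extendʳ b) ∘ place x) (λ q → [ extendʳ (x ∷ b) q ]) (splits a) ⟨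
      concatMap (place₃ x ∘ extendʳ b) (splits a)
        ≡⟨ List.concatMap-map (place₃ x) (extendʳ b) (splits a) ⟨
      concatMap (place₃ x) (refineˡ (a , b)) ∎

  refineʳ-splits₃ : ∀ w → concatMap refineʳ (splits w) ↭ splits₃ w
  refineʳ-splits₃ []      = ↭-refl
  refineʳ-splits₃ (x ∷ w) = begin
    concatMap refineʳ (concatMap (place x) (splits w))     ≡⟨ concatMap-concatMap refineʳ (place x) (splits w) ⟩
    concatMap (concatMap refineʳ ∘ place x) (splits w)     ↭⟨ concatMap-↭ (splits w) refine-placed ⟩
    concatMap (concatMap (place₃ x) ∘ refineʳ) (splits w)  ≡⟨ concatMap-concatMap (place₃ x) refineʳ (splits w) ⟨
    concatMap (place₃ x) (concatMap refineʳ (splits w))    ↭⟨ concatMap⁺ (place₃ x) (refineʳ-splits₃ w) ⟩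
    concatMap (place₃ x) (splits₃ w)                       ∎
    where
    open PermutationReasoning
    refine-placed : ∀ p → concatMap refineʳ (place x p) ↭ concatMap (place₃ x) (refineʳ p)
    refine-placed (a , b) = begin
      refineʳ (x ∷ a , b) ++ refineʳ (a , x ∷ b) ++ []
        ≡⟨ cong (refineʳ (x ∷ a , b) ++_) (List.++-identityʳ _) ⟩
      map (x ∷ a ,_) (splits b) ++ map (a ,_) (concatMap (place x) (splits b))
        ≡⟨ cong₂ _++_ (map-as-concatMap (x ∷ a ,_) (splits b)) (List.map-concatMap (a ,_) (place x) (splits b)) ⟩
      concatMap (λ q → [ (x ∷ a , q) ]) (splits b) ++ concatMap (map (a ,_) ∘ place x) (splits b)
        ↭⟨ concatMap-++ (λ q → [ (x ∷ a , q) ]) (map (a ,_) ∘ place x) (splits b) ⟨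
      concatMap (place₃ x ∘ (a ,_)) (splits b)
        ≡⟨ List.concatMap-map (place₃ x) (a ,_) (splits b) ⟨
      concatMap (place₃ x) (refineʳ (a , b)) ∎

  refineˡ↭refineʳ : ∀ w → concatMap refineˡ (splits w) ↭ concatMap refineʳ (splits w)
  refineˡ↭refineʳ w = ↭-trans (refineˡ-splits₃ w) (↭-sym (refineʳ-splits₃ w))

  cut : Split → Split
  cut (I , J) = (pack I , pack (J /W I))

  terms : Word → List Split
  terms w = map cut (splits w)

  terms-packed : ∀ w → All (λ p → IsPacked (proj₁ p) × IsPacked (proj₂ p)) (terms w)
  terms-packed w = All.map⁺ (tabulate (λ {p} _ → pack-idem (proj₁ p) , pack-idem (proj₂ p /W proj₁ p)))

  terms-length : ∀ w → All (λ p → length (proj₁ p) + length (proj₂ p) ≡ length w) (terms w)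
  terms-length w = All.map⁺ (All.map (λ {p} → lengths {p}) (splits-interleave w))
    where
    lengths : ∀ {p} → Interleaves w p → length (pack (proj₁ p)) + length (pack (proj₂ p /W proj₁ p)) ≡ length w
    lengths {a , b} ab↭w = trans (cong₂ _+_ (List.length-map _ a)
      (trans (List.length-map _ (b /W a)) (List.length-map _ b))) (Interleaving.length-sum {w} {a} {b} ab↭w)

  -- the term of (Δ ⊗ id)Δ(w), and of (id ⊗ Δ)Δ(w), indexed by a three-way splitting
  cut₃ : Split₃ → Split₃
  cut₃ (a , (b , c)) = (pack a , (pack (b /W a) , pack (c /W (a ++ b))))

  termsˡ termsʳ : Word → List Split₃
  termsˡ w = concatMap (λ p → map (extendʳ (proj₂ p)) (terms (proj₁ p))) (terms w)
  termsʳ w = concatMap (λ p → map (proj₁ p ,_) (terms (proj₂ p))) (terms w)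

  termsˡ-cut₃ : ∀ w → termsˡ w ≡ map cut₃ (concatMap refineˡ (splits w))
  termsˡ-cut₃ w = trans (List.concatMap-map _ cut (splits w))
    (trans (List.concatMap-cong recut (splits w)) (sym (List.map-concatMap cut₃ refineˡ (splits w))))
    where
    open ≡-Reasoning
    recut : ∀ p → map (extendʳ (proj₂ (cut p))) (terms (proj₁ (cut p))) ≡ map cut₃ (refineˡ p)
    recut (I , J) = begin
      map (extendʳ (pack (J /W I))) (map cut (splits (map (φ I) I)))
        ≡⟨ cong (λ z → map (extendʳ (pack (J /W I))) (map cut z)) (splits-map (φ I) I) ⟩
      map (extendʳ (pack (J /W I))) (map cut (map (mapBoth (φ I)) (splits I)))
        ≡⟨ sym (trans (List.map-∘ (splits I)) (List.map-∘ (map (mapBoth (φ I)) (splits I)))) ⟩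
      map (λ q → (pack (map (φ I) (proj₁ q)) ,
                  (pack (map (φ I) (proj₂ q) /W map (φ I) (proj₁ q)) , pack (J /W I)))) (splits I)
        ≡⟨ List.map-cong-local (All.map (λ {q} → same {q}) (splits-interleave I)) ⟩
      map (λ q → cut₃ (proj₁ q , (proj₂ q , J))) (splits I)
        ≡⟨ List.map-∘ (splits I) ⟩
      map cut₃ (refineˡ (I , J)) ∎
      where
      same : ∀ {q} → Interleaves I q →
        (pack (map (φ I) (proj₁ q)) , (pack (map (φ I) (proj₂ q) /W map (φ I) (proj₁ q)) , pack (J /W I)))
          ≡ cut₃ (proj₁ q , (proj₂ q , J))
      same {a , b} ab↭I =
        cong₂ _,_ (pack-relabel a I a⊑I) (cong₂ _,_ (pack-relabel-erase a b I a⊑I b⊑I) third)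
        where
        open Interleaving {I} {a} {b} ab↭I renaming (left⊑ to a⊑I; right⊑ to b⊑I)
        third : pack (J /W I) ≡ pack (J /W (a ++ b))
        third = cong pack (erase-cong J I (a ++ b) (λ y → sym (occurs-union y)))

  termsʳ-cut₃ : ∀ w → termsʳ w ≡ map cut₃ (concatMap refineʳ (splits w))
  termsʳ-cut₃ w = trans (List.concatMap-map _ cut (splits w))
    (trans (List.concatMap-cong recut (splits w)) (sym (List.map-concatMap cut₃ refineʳ (splits w))))
    where
    open ≡-Reasoning
    recut : ∀ p → map (proj₁ (cut p) ,_) (terms (proj₂ (cut p))) ≡ map cut₃ (refineʳ p)
    recut (I , J) = begin
      map (pack I ,_) (map cut (splits (map (φ U) U)))
        ≡⟨ cong (λ z → map (pack I ,_) (map cut z))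
                (trans (splits-map (φ U) U) (cong (map (mapBoth (φ U))) (splits-map (erase I) J))) ⟩
      map (pack I ,_) (map cut (map (mapBoth (φ U)) (map (mapBoth (erase I)) (splits J))))
        ≡⟨ sym (trans (List.map-∘ (splits J)) (trans (List.map-∘ (map (mapBoth (erase I)) (splits J)))
                (List.map-∘ (map (mapBoth (φ U)) (map (mapBoth (erase I)) (splits J)))))) ⟩
      map (λ q → (pack I , (pack (map (φ U) (proj₁ q /W I)) ,
                            pack (map (φ U) (proj₂ q /W I) /W map (φ U) (proj₁ q /W I))))) (splits J)
        ≡⟨ List.map-cong-local (All.map (λ {q} → same {q}) (splits-interleave J)) ⟩
      map (λ q → cut₃ (I , q)) (splits J)
        ≡⟨ List.map-∘ (splits J) ⟩
      map cut₃ (refineʳ (I , J)) ∎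
      where
      U : Word
      U = J /W I
      same : ∀ {q} → Interleaves J q →
        (pack I , (pack (map (φ U) (proj₁ q /W I)) , pack (map (φ U) (proj₂ q /W I) /W map (φ U) (proj₁ q /W I))))
          ≡ cut₃ (I , q)
      same {c , d} cd↭J = cong (pack I ,_) (cong₂ _,_ (pack-relabel (c /W I) U c'⊑U) second)
        where
        open Interleaving {J} {c} {d} cd↭J using (left⊑; right⊑)
        c'⊑U : (c /W I) ⊑ U
        c'⊑U = ⊑-erase-both c J I left⊑
        d'⊑U : (d /W I) ⊑ U
        d'⊑U = ⊑-erase-both d J I right⊑
        second : pack (map (φ U) (d /W I) /W map (φ U) (c /W I)) ≡ pack (d /W (I ++ c))
        second = trans (pack-relabel-erase (c /W I) (d /W I) U c'⊑U d'⊑U) (cong pack (erase-erase d I c))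

  -- coassociativity, at the level of the indexing multisets
  termsˡ↭termsʳ : ∀ w → termsˡ w ↭ termsʳ w
  termsˡ↭termsʳ w = subst₂ _↭_ (sym (termsˡ-cut₃ w)) (sym (termsʳ-cut₃ w)) (map⁺ cut₃ (refineˡ↭refineʳ w))

  _✶₂_ : Split → Split → Split
  (a , b) ✶₂ (c , d) = (a ✶ c , b ✶ d)

  cut-blocks : ∀ s a b c d → Bounded a s → Bounded b s →
    cut ((a , b) ++₂ mapBoth (shiftBy s) (c , d)) ≡ cut (a , b) ✶₂ cut (c , d)
  cut-blocks s a b c d a≤s b≤s = cong₂ _,_ first second
    where
    open ≡-Reasoning
    first : pack (a ++ map (shiftBy s) c) ≡ pack a ✶ pack c
    first = trans (cong (λ z → pack (a ++ z)) (sym (T≡map s c))) (pack-blocks a c s a≤s)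
    second : pack ((b ++ map (shiftBy s) d) /W (a ++ map (shiftBy s) c)) ≡ pack (b /W a) ✶ pack (d /W c)
    second = begin
      pack ((b ++ map (shiftBy s) d) /W (a ++ map (shiftBy s) c))
        ≡⟨ cong pack (erase-blocks a c s a≤s b d b≤s) ⟩
      pack ((b /W a) ++ map (shiftBy s) (d /W c))
        ≡⟨ cong (λ z → pack ((b /W a) ++ z)) (sym (T≡map s (d /W c))) ⟩
      pack ((b /W a) ++ T s (d /W c))
        ≡⟨ pack-blocks (b /W a) (d /W c) s (bounded-erase a b≤s) ⟩
      pack (b /W a) ✶ pack (d /W c) ∎

  -- multiplicativity of Δ, at the level of the indexing multisets
  terms-✶ : ∀ u v → terms (u ✶ v) ↭ concatMap (λ p → map (p ✶₂_) (terms v)) (terms u)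
  terms-✶ u v =
    subst (λ z → map cut (splits (u ++ z)) ↭ concatMap (λ p → map (p ✶₂_) (terms v)) (terms u)) (sym (T≡map s v))
    (↭-trans (map⁺ cut (splits-++ u (map (shiftBy s) v)))
    (↭-reflexive (begin
      map cut (concatMap (λ p → map (p ++₂_) (splits (map (shiftBy s) v))) (splits u))
        ≡⟨ List.map-concatMap cut _ (splits u) ⟩
      concatMap (λ p → map cut (map (p ++₂_) (splits (map (shiftBy s) v)))) (splits u)
        ≡⟨ concatMap-cong-All (λ {p} → cut-both {p}) (splits-interleave u) ⟩
      concatMap (λ p → map (λ q → cut p ✶₂ cut q) (splits v)) (splits u)
        ≡⟨ List.concatMap-cong (λ p → List.map-∘ (splits v)) (splits u) ⟩
      concatMap (λ p → map (cut p ✶₂_) (terms v)) (splits u)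
        ≡⟨ sym (List.concatMap-map _ cut (splits u)) ⟩
      concatMap (λ p → map (p ✶₂_) (terms v)) (terms u) ∎)))
    where
    open ≡-Reasoning
    s = sup u
    cut-both : ∀ {p} → Interleaves u p →
      map cut (map (p ++₂_) (splits (map (shiftBy s) v))) ≡ map (λ q → cut p ✶₂ cut q) (splits v)
    cut-both {a , b} ab↭u = begin
      map cut (map ((a , b) ++₂_) (splits (map (shiftBy s) v)))
        ≡⟨ cong (map cut ∘ map ((a , b) ++₂_)) (splits-map (shiftBy s) v) ⟩
      map cut (map ((a , b) ++₂_) (map (mapBoth (shiftBy s)) (splits v)))
        ≡⟨ sym (trans (List.map-∘ (splits v)) (List.map-∘ (map (mapBoth (shiftBy s)) (splits v)))) ⟩
      map (λ q → cut ((a , b) ++₂ mapBoth (shiftBy s) q)) (splits v)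
        ≡⟨ List.map-cong (λ q → cut-blocks s a b (proj₁ q) (proj₂ q)
                                   (left-bounded (sup-bounded u)) (right-bounded (sup-bounded u))) (splits v) ⟩
      map (λ q → cut (a , b) ✶₂ cut q) (splits v) ∎
      where open Interleaving {u} {a} {b} ab↭u using (left-bounded; right-bounded)


-- Two combinations with the same pairing against every
-- Φ : B → K have the same coefficients, so all identities of the theorem are
-- proved as identities of pairings.
module Linear {c ℓ : Level} (K : Field c ℓ) where

  open Field K
  open Hopf K
  open import Level using (_⊔_)
  open import Data.Bool using (true; false; if_then_else_)
  open import Data.List using (List; []; _∷_; _++_; map; foldr; concatMap)
  open Words using (_✶₂_)
  open import Data.List.Relation.Unary.All using (All; []; _∷_)
  open import Data.List.Relation.Binary.Permutation.Propositional using (_↭_; ↭⇒↭ₛ′)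
  open import Data.List.Relation.Binary.Permutation.Propositional.Properties using (map⁺)
  open import Data.List.Relation.Binary.Permutation.Setoid.Properties setoid using (foldr-commMonoid)
  open import Data.Product using (_,_; proj₁; proj₂)
  open import Relation.Nullary using (does)
  open import Relation.Binary using (DecidableEquality)
  open import Relation.Binary.Reasoning.Setoid setoid
  open import Function using (_∘_)
  open import Algebra.Properties.CommutativeSemigroup +-commutativeSemigroup
    using () renaming (interchange to +-interchange)

  private variable
    ℓ₁ ℓ₂ : Level
    X : Set ℓ₁
    Y : Set ℓ₂
    A B C : Set

  ∑ : (X → Carrier) → List X → Carrier
  ∑ f xs = foldr _+_ 0# (map f xs)

  ∑-cong : ∀ {f g : X → Carrier} xs → (∀ x → f x ≈ g x) → ∑ f xs ≈ ∑ g xs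
  ∑-cong []       f≈g = refl
  ∑-cong (x ∷ xs) f≈g = +-cong (f≈g x) (∑-cong xs f≈g)

  ∑-cong-All : ∀ {f g : X → Carrier} {P : X → Set} {xs} →
               (∀ {x} → P x → f x ≈ g x) → All P xs → ∑ f xs ≈ ∑ g xs
  ∑-cong-All f≈g []         = refl
  ∑-cong-All f≈g (px ∷ pxs) = +-cong (f≈g px) (∑-cong-All f≈g pxs)

  ∑-++ : ∀ (f : X → Carrier) xs ys → ∑ f (xs ++ ys) ≈ ∑ f xs + ∑ f ys
  ∑-++ f []       ys = sym (+-identityˡ _)
  ∑-++ f (x ∷ xs) ys = trans (+-congˡ (∑-++ f xs ys)) (sym (+-assoc _ _ _))

  ∑-concatMap : ∀ (f : Y → Carrier) (g : X → List Y) xs → ∑ f (concatMap g xs) ≈ ∑ (λ x → ∑ f (g x)) xs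
  ∑-concatMap f g []       = refl
  ∑-concatMap f g (x ∷ xs) = trans (∑-++ f (g x) _) (+-congˡ (∑-concatMap f g xs))

  ∑-map : ∀ (f : Y → Carrier) (h : X → Y) xs → ∑ f (map h xs) ≈ ∑ (f ∘ h) xs
  ∑-map f h []       = refl
  ∑-map f h (x ∷ xs) = +-congˡ (∑-map f h xs)

  ∑-↭ : ∀ (f : X → Carrier) {xs ys} → xs ↭ ys → ∑ f xs ≈ ∑ f ys
  ∑-↭ f p = foldr-commMonoid +-isCommutativeMonoid (↭⇒↭ₛ′ isEquivalence (map⁺ f p))

  *-∑ : ∀ a (f : X → Carrier) xs → a * ∑ f xs ≈ ∑ (λ x → a * f x) xs
  *-∑ a f []       = zeroʳ a
  *-∑ a f (x ∷ xs) = trans (distribˡ a _ _) (+-congˡ (*-∑ a f xs))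

  ∑-+ : ∀ (f g : X → Carrier) xs → ∑ (λ x → f x + g x) xs ≈ ∑ f xs + ∑ g xs
  ∑-+ f g []       = sym (+-identityˡ 0#)
  ∑-+ f g (x ∷ xs) = trans (+-congˡ (∑-+ f g xs)) (+-interchange _ _ _ _)

  ∑-zero : ∀ (xs : List X) → ∑ (λ _ → 0#) xs ≈ 0#
  ∑-zero []       = refl
  ∑-zero (x ∷ xs) = trans (+-identityˡ _) (∑-zero xs)

  ∑-comm : ∀ (F : X → Y → Carrier) xs ys → ∑ (λ x → ∑ (F x) ys) xs ≈ ∑ (λ y → ∑ (λ x → F x y) xs) ys
  ∑-comm F []       ys = sym (∑-zero ys)
  ∑-comm F (x ∷ xs) ys = trans (+-congˡ (∑-comm F xs ys)) (sym (∑-+ (F x) _ ys))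

  ⟨_∣_⟩ : Lin A → (A → Carrier) → Carrier
  ⟨ x ∣ Φ ⟩ = ∑ (λ p → proj₁ p * Φ (proj₂ p)) x

  _≐_ : Lin A → Lin A → Set (c ⊔ ℓ)
  x ≐ y = ∀ Φ → ⟨ x ∣ Φ ⟩ ≈ ⟨ y ∣ Φ ⟩

  ⟨⟩-cong : ∀ (x : Lin A) {Φ Ψ} → (∀ b → Φ b ≈ Ψ b) → ⟨ x ∣ Φ ⟩ ≈ ⟨ x ∣ Ψ ⟩
  ⟨⟩-cong x Φ≈Ψ = ∑-cong x (λ p → *-congˡ (Φ≈Ψ (proj₂ p)))

  ⟨⟩-⟦⟧ : ∀ (b : A) Φ → ⟨ ⟦ b ⟧ ∣ Φ ⟩ ≈ Φ b
  ⟨⟩-⟦⟧ b Φ = trans (+-identityʳ _) (*-identityˡ _)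

  ⟨⟩-· : ∀ a (x : Lin A) Φ → ⟨ a · x ∣ Φ ⟩ ≈ a * ⟨ x ∣ Φ ⟩
  ⟨⟩-· a x Φ = trans (∑-map _ _ x) (trans (∑-cong x (λ p → *-assoc a _ _)) (sym (*-∑ a _ x)))

  ⟨⟩-scale : ∀ (x : Lin A) a Φ → ⟨ x ∣ (λ b → a * Φ b) ⟩ ≈ a * ⟨ x ∣ Φ ⟩
  ⟨⟩-scale x a Φ = trans (∑-cong x (λ p → x*[a*y]≈a*[x*y] (proj₁ p) a _)) (sym (*-∑ a _ x))
    where
    x*[a*y]≈a*[x*y] : ∀ x a y → x * (a * y) ≈ a * (x * y)
    x*[a*y]≈a*[x*y] x a y = trans (sym (*-assoc x a y)) (trans (*-congʳ (*-comm x a)) (*-assoc a x y))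

  ⟨⟩-linExt : ∀ (f : A → Lin B) x Φ → ⟨ linExt f x ∣ Φ ⟩ ≈ ⟨ x ∣ (λ a → ⟨ f a ∣ Φ ⟩) ⟩
  ⟨⟩-linExt f x Φ = trans (∑-concatMap _ _ x) (∑-cong x (λ p → ⟨⟩-· (proj₁ p) (f (proj₂ p)) Φ))

  ⟨⟩-∑ : ∀ (x : Lin A) (F : A → C → Carrier) ys →
         ⟨ x ∣ (λ a → ∑ (F a) ys) ⟩ ≈ ∑ (λ y → ⟨ x ∣ (λ a → F a y) ⟩) ys
  ⟨⟩-∑ x F ys = trans (∑-cong x (λ p → *-∑ (proj₁ p) _ ys)) (∑-comm _ x ys)

  basisSum : List A → Lin A
  basisSum = map (λ b → (1# , b))

  ⟨⟩-basisSum : ∀ (bs : List A) Φ → ⟨ basisSum bs ∣ Φ ⟩ ≈ ∑ Φ bs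
  ⟨⟩-basisSum bs Φ = trans (∑-map _ _ bs) (∑-cong bs (λ b → *-identityˡ _))

  ⟨⟩-mul : ∀ x y Φ → ⟨ mul x y ∣ Φ ⟩ ≈ ⟨ x ∣ (λ u → ⟨ y ∣ (λ v → Φ (u ✶ v)) ⟩) ⟩
  ⟨⟩-mul x y Φ = trans (⟨⟩-linExt (λ u → linExt (λ v → ⟦ u ✶ v ⟧) y) x Φ) (⟨⟩-cong x (λ u →
    trans (⟨⟩-linExt (λ v → ⟦ u ✶ v ⟧) y Φ) (⟨⟩-cong y (λ v → ⟨⟩-⟦⟧ (u ✶ v) Φ))))

  ⟨⟩-mul⊗ : ∀ x y Φ → ⟨ mul⊗ x y ∣ Φ ⟩ ≈ ⟨ x ∣ (λ p → ⟨ y ∣ (λ q → Φ (p ✶₂ q)) ⟩) ⟩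
  ⟨⟩-mul⊗ x y Φ = trans (⟨⟩-linExt (λ p → linExt (λ q → ⟦ p ✶₂ q ⟧) y) x Φ) (⟨⟩-cong x (λ p →
    trans (⟨⟩-linExt (λ q → ⟦ p ✶₂ q ⟧) y Φ) (⟨⟩-cong y (λ q → ⟨⟩-⟦⟧ (p ✶₂ q) Φ))))

  -- a coefficient is the pairing with an indicator functional, so ≐ implies LinEq
  ≐⇒LinEq : ∀ {A : Set} (_≟_ : DecidableEquality A) (x y : Lin A) → x ≐ y → LinEq _≟_ x y
  ≐⇒LinEq {A} _≟_ x y x≐y b = trans (coeff≈⟨⟩ x) (trans (x≐y (δ b)) (sym (coeff≈⟨⟩ y)))
    where
    δ : A → A → Carrier
    δ b b' = if does (b' ≟ b) then 1# else 0#
    coeff≈⟨⟩ : ∀ (x : Lin A) → coeff _≟_ x b ≈ ⟨ x ∣ δ b ⟩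
    coeff≈⟨⟩ []             = refl
    coeff≈⟨⟩ ((a , b') ∷ x) = +-cong coeff-head (coeff≈⟨⟩ x)
      where
      coeff-head : (if does (b' ≟ b) then a else 0#) ≈ a * δ b b'
      coeff-head with does (b' ≟ b)
      ... | true  = sym (*-identityʳ a)
      ... | false = sym (zeroʳ a)


module Bialgebra {c ℓ : Level} (K : Field c ℓ) where

  open Field K
  open Hopf K
  open Linear K
  open Words
  open import Data.Nat using (ℕ)
  open import Data.List using (List; []; _∷_; map; length; concatMap)
  import Data.List.Properties as List
  open import Data.Product using (_,_; proj₁; proj₂)
  open import Function using (_∘_)
  import Relation.Binary.PropositionalEquality as P
  open import Relation.Binary.Reasoning.Setoid setoid

  Δ≡terms : ∀ w → Δ w P.≡ basisSum (terms w)
  Δ≡terms w = P.sym (P.trans (P.cong (basisSum ∘ map cut) (P.sym (splits-masks w)))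
                             (P.trans (P.sym (List.map-∘ _)) (P.sym (List.map-∘ (masks (length w))))))

  ⟨Δ∣⟩ : ∀ w Φ → ⟨ Δ w ∣ Φ ⟩ ≈ ∑ Φ (terms w)
  ⟨Δ∣⟩ w Φ = trans (reflexive (P.cong ⟨_∣ Φ ⟩ (Δ≡terms w))) (⟨⟩-basisSum (terms w) Φ)

  ⟨ΔΔ∣⟩ : ∀ {T : Set} (k : Split → Split → T) (part : Split → Word) w Φ →
    ⟨ linExt (λ p → linExt (λ q → ⟦ k p q ⟧) (Δ (part p))) (Δ w) ∣ Φ ⟩
      ≈ ∑ Φ (concatMap (λ p → map (k p) (terms (part p))) (terms w))
  ⟨ΔΔ∣⟩ k part w Φ = begin
    ⟨ linExt (λ p → linExt (λ q → ⟦ k p q ⟧) (Δ (part p))) (Δ w) ∣ Φ ⟩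
      ≈⟨ ⟨⟩-linExt (λ p → linExt (λ q → ⟦ k p q ⟧) (Δ (part p))) (Δ w) Φ ⟩
    ⟨ Δ w ∣ (λ p → ⟨ linExt (λ q → ⟦ k p q ⟧) (Δ (part p)) ∣ Φ ⟩) ⟩
      ≈⟨ ⟨⟩-cong (Δ w) (λ p → trans (⟨⟩-linExt (λ q → ⟦ k p q ⟧) (Δ (part p)) Φ)
                               (trans (⟨⟩-cong (Δ (part p)) (λ q → ⟨⟩-⟦⟧ (k p q) Φ)) (⟨Δ∣⟩ (part p) _))) ⟩
    ⟨ Δ w ∣ (λ p → ∑ (λ q → Φ (k p q)) (terms (part p))) ⟩
      ≈⟨ ⟨Δ∣⟩ w _ ⟩
    ∑ (λ p → ∑ (λ q → Φ (k p q)) (terms (part p))) (terms w)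
      ≈⟨ ∑-cong (terms w) (λ p → sym (∑-map Φ (k p) (terms (part p)))) ⟩
    ∑ (λ p → ∑ Φ (map (k p) (terms (part p)))) (terms w)
      ≈⟨ sym (∑-concatMap Φ _ (terms w)) ⟩
    ∑ Φ (concatMap (λ p → map (k p) (terms (part p))) (terms w)) ∎

  coassociative : ∀ w → Δ⊗id (Δ w) ≐ id⊗Δ (Δ w)
  coassociative w Φ = begin
    ⟨ Δ⊗id (Δ w) ∣ Φ ⟩  ≈⟨ ⟨ΔΔ∣⟩ (extendʳ ∘ proj₂) proj₁ w Φ ⟩
    ∑ Φ (termsˡ w)      ≈⟨ ∑-↭ Φ (termsˡ↭termsʳ w) ⟩
    ∑ Φ (termsʳ w)      ≈⟨ sym (⟨ΔΔ∣⟩ (λ p → proj₁ p ,_) proj₂ w Φ) ⟩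
    ⟨ id⊗Δ (Δ w) ∣ Φ ⟩  ∎

  Δ-multiplicative : ∀ u v → Δ (u ✶ v) ≐ mul⊗ (Δ u) (Δ v)
  Δ-multiplicative u v Φ = begin
    ⟨ Δ (u ✶ v) ∣ Φ ⟩                                         ≈⟨ ⟨Δ∣⟩ (u ✶ v) Φ ⟩
    ∑ Φ (terms (u ✶ v))                                       ≈⟨ ∑-↭ Φ (terms-✶ u v) ⟩
    ∑ Φ (concatMap (λ p → map (p ✶₂_) (terms v)) (terms u))   ≈⟨ ∑-concatMap Φ _ (terms u) ⟩
    ∑ (λ p → ∑ Φ (map (p ✶₂_) (terms v))) (terms u)           ≈⟨ ∑-cong (terms u) (λ p → ∑-map Φ (p ✶₂_) (terms v)) ⟩
    ∑ (λ p → ∑ (λ q → Φ (p ✶₂ q)) (terms v)) (terms u)        ≈⟨ sym (⟨Δ∣⟩ u _) ⟩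
    ⟨ Δ u ∣ (λ p → ∑ (λ q → Φ (p ✶₂ q)) (terms v)) ⟩          ≈⟨ sym (⟨⟩-cong (Δ u) (λ p → ⟨Δ∣⟩ v _)) ⟩
    ⟨ Δ u ∣ (λ p → ⟨ Δ v ∣ (λ q → Φ (p ✶₂ q)) ⟩) ⟩            ≈⟨ sym (⟨⟩-mul⊗ (Δ u) (Δ v) Φ) ⟩
    ⟨ mul⊗ (Δ u) (Δ v) ∣ Φ ⟩                                  ∎

  -- ε kills every splitting with a nonempty first (resp. second) part
  ε-first : ∀ w (H : Split → Carrier) → ∑ (λ p → ε (proj₁ p) * H p) (splits w) ≈ H ([] , w)
  ε-first []      H = trans (+-identityʳ _) (*-identityˡ _)
  ε-first (x ∷ w) H = begin
    ∑ F (concatMap (place x) (splits w))                      ≈⟨ ∑-concatMap F (place x) (splits w) ⟩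
    ∑ (λ p → ∑ F (place x p)) (splits w)                      ≈⟨ ∑-cong (splits w) placed ⟩
    ∑ (λ p → ε (proj₁ p) * H (proj₁ p , x ∷ proj₂ p)) (splits w) ≈⟨ ε-first w (λ p → H (proj₁ p , x ∷ proj₂ p)) ⟩
    H ([] , x ∷ w)                                            ∎
    where
    F : Split → Carrier
    F p = ε (proj₁ p) * H p
    placed : ∀ p → ∑ F (place x p) ≈ ε (proj₁ p) * H (proj₁ p , x ∷ proj₂ p)
    placed (a , b) = trans (+-cong (zeroˡ _) (+-identityʳ _)) (+-identityˡ _)

  ε-second : ∀ w (H : Split → Carrier) → ∑ (λ p → ε (proj₂ p) * H p) (splits w) ≈ H (w , [])
  ε-second []      H = trans (+-identityʳ _) (*-identityˡ _)
  ε-second (x ∷ w) H = begin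
    ∑ F (concatMap (place x) (splits w))                      ≈⟨ ∑-concatMap F (place x) (splits w) ⟩
    ∑ (λ p → ∑ F (place x p)) (splits w)                      ≈⟨ ∑-cong (splits w) placed ⟩
    ∑ (λ p → ε (proj₂ p) * H (x ∷ proj₁ p , proj₂ p)) (splits w) ≈⟨ ε-second w (λ p → H (x ∷ proj₁ p , proj₂ p)) ⟩
    H (x ∷ w , [])                                            ∎
    where
    F : Split → Carrier
    F p = ε (proj₂ p) * H p
    placed : ∀ p → ∑ F (place x p) ≈ ε (proj₂ p) * H (x ∷ proj₁ p , proj₂ p)
    placed (a , b) = trans (+-congˡ (trans (+-identityʳ _) (zeroˡ _))) (+-identityʳ _)

  ε-map : ∀ (f : ℕ → ℕ) w → ε (map f w) P.≡ ε w
  ε-map f []      = P.refl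
  ε-map f (_ ∷ _) = P.refl

  -- the counit sums of Δ(w): only the terms (1 , w) and (w , 1) survive
  ε-terms-first : ∀ w → IsPacked w → ∀ (H : Word → Carrier) → ∑ (λ p → ε (proj₁ p) * H (proj₂ p)) (terms w) ≈ H w
  ε-terms-first w w-packed H = begin
    ∑ (λ p → ε (proj₁ p) * H (proj₂ p)) (terms w)
      ≈⟨ ∑-map _ cut (splits w) ⟩
    ∑ (λ p → ε (pack (proj₁ p)) * H (pack (proj₂ p /W proj₁ p))) (splits w)
      ≈⟨ ∑-cong (splits w) (λ p → *-congʳ (reflexive (ε-map _ (proj₁ p)))) ⟩
    ∑ (λ p → ε (proj₁ p) * H (pack (proj₂ p /W proj₁ p))) (splits w)
      ≈⟨ ε-first w (λ p → H (pack (proj₂ p /W proj₁ p))) ⟩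
    H (pack (w /W []))
      ≈⟨ reflexive (P.cong H (P.trans (P.cong pack (erase-nothing w)) w-packed)) ⟩
    H w ∎

  ε-terms-second : ∀ w → IsPacked w → ∀ (H : Word → Carrier) → ∑ (λ p → ε (proj₂ p) * H (proj₁ p)) (terms w) ≈ H w
  ε-terms-second w w-packed H = begin
    ∑ (λ p → ε (proj₂ p) * H (proj₁ p)) (terms w)
      ≈⟨ ∑-map _ cut (splits w) ⟩
    ∑ (λ p → ε (pack (proj₂ p /W proj₁ p)) * H (pack (proj₁ p))) (splits w)
      ≈⟨ ∑-cong (splits w) (λ p → *-congʳ (reflexive (P.trans (ε-map _ (proj₂ p /W proj₁ p)) (ε-map _ (proj₂ p))))) ⟩
    ∑ (λ p → ε (proj₂ p) * H (pack (proj₁ p))) (splits w)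
      ≈⟨ ε-second w (λ p → H (pack (proj₁ p))) ⟩
    H (pack w)
      ≈⟨ reflexive (P.cong H w-packed) ⟩
    H w ∎

  ⟨εΔ∣⟩ : ∀ (killed kept : Split → Word) w Φ →
    ⟨ linExt (λ p → ε (killed p) · ⟦ kept p ⟧) (Δ w) ∣ Φ ⟩ ≈ ∑ (λ p → ε (killed p) * Φ (kept p)) (terms w)
  ⟨εΔ∣⟩ killed kept w Φ = begin
    ⟨ linExt (λ p → ε (killed p) · ⟦ kept p ⟧) (Δ w) ∣ Φ ⟩
      ≈⟨ ⟨⟩-linExt (λ p → ε (killed p) · ⟦ kept p ⟧) (Δ w) Φ ⟩
    ⟨ Δ w ∣ (λ p → ⟨ ε (killed p) · ⟦ kept p ⟧ ∣ Φ ⟩) ⟩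
      ≈⟨ ⟨⟩-cong (Δ w) (λ p → trans (⟨⟩-· _ ⟦ kept p ⟧ Φ) (*-congˡ (⟨⟩-⟦⟧ (kept p) Φ))) ⟩
    ⟨ Δ w ∣ (λ p → ε (killed p) * Φ (kept p)) ⟩
      ≈⟨ ⟨Δ∣⟩ w _ ⟩
    ∑ (λ p → ε (killed p) * Φ (kept p)) (terms w) ∎

  counit-left : ∀ w → IsPacked w → ε⊗id (Δ w) ≐ ⟦ w ⟧
  counit-left w w-packed Φ =
    trans (⟨εΔ∣⟩ proj₁ proj₂ w Φ) (trans (ε-terms-first w w-packed Φ) (sym (⟨⟩-⟦⟧ w Φ)))

  counit-right : ∀ w → IsPacked w → id⊗ε (Δ w) ≐ ⟦ w ⟧
  counit-right w w-packed Φ =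
    trans (⟨εΔ∣⟩ proj₂ proj₁ w Φ) (trans (ε-terms-second w w-packed Φ) (sym (⟨⟩-⟦⟧ w Φ)))

  ε-multiplicative : ∀ u v → ε (u ✶ v) ≈ ε u * ε v
  ε-multiplicative []      []      = sym (*-identityˡ _)
  ε-multiplicative []      (_ ∷ _) = sym (zeroʳ _)
  ε-multiplicative (_ ∷ _) v       = sym (zeroˡ _)


module Antipode {c ℓ : Level} (K : Field c ℓ) where

  open Field K
  open Hopf K
  open Linear K
  open Bialgebra K
  open Words
  open import Data.Nat using (ℕ; zero; suc; _≤_; s≤s) renaming (_+_ to _+ℕ_)
  open import Data.Nat.Properties using (≤-refl; ≤-trans; m≤m+n; +-suc; suc-injective)
    renaming (+-comm to +ℕ-comm)
  open import Data.List using ([]; _∷_; map; length)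
  open import Data.List.Relation.Unary.All using (All; []; _∷_)
  import Data.List.Relation.Unary.All.Properties as All
  open import Data.Product using (_×_; _,_; proj₁; proj₂)
  open import Data.Sum using (_⊎_; inj₁; inj₂)
  open import Function using (_∘_)
  import Relation.Binary.PropositionalEquality as P
  open import Relation.Binary.Reasoning.Setoid setoid
  open import Algebra.Properties.Ring ring using (-1*x≈-x)
  open import Level using (_⊔_)

  _⋆_ : (Word → Lin Word) → (Word → Lin Word) → Word → Lin Word
  (f ⋆ g) w = m∘⊗ f g (Δ w)

  η∘ε : Word → Lin Word
  η∘ε w = ε w · ⟦ [] ⟧

  ⟨⋆∣⟩ : ∀ f g w Φ → ⟨ (f ⋆ g) w ∣ Φ ⟩ ≈
         ∑ (λ p → ⟨ f (proj₁ p) ∣ (λ u → ⟨ g (proj₂ p) ∣ (λ v → Φ (u ✶ v)) ⟩) ⟩) (terms w)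
  ⟨⋆∣⟩ f g w Φ = trans (⟨⟩-linExt (λ p → mul (f (proj₁ p)) (g (proj₂ p))) (Δ w) Φ)
    (trans (⟨⟩-cong (Δ w) (λ p → ⟨⟩-mul (f (proj₁ p)) (g (proj₂ p)) Φ)) (⟨Δ∣⟩ w _))

  ⟨η∘ε∣⟩ : ∀ w Φ → ⟨ η∘ε w ∣ Φ ⟩ ≈ ε w * Φ []
  ⟨η∘ε∣⟩ w Φ = trans (⟨⟩-· (ε w) ⟦ [] ⟧ Φ) (*-congˡ (⟨⟩-⟦⟧ [] Φ))

  ⋆-identityʳ : ∀ f w → IsPacked w → (f ⋆ η∘ε) w ≐ f w
  ⋆-identityʳ f w w-packed Φ =
    trans (⟨⋆∣⟩ f η∘ε w Φ) (trans (∑-cong (terms w) unit) (ε-terms-second w w-packed (λ a → ⟨ f a ∣ Φ ⟩)))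
    where
    unit : ∀ p → ⟨ f (proj₁ p) ∣ (λ u → ⟨ η∘ε (proj₂ p) ∣ (λ v → Φ (u ✶ v)) ⟩) ⟩ ≈ ε (proj₂ p) * ⟨ f (proj₁ p) ∣ Φ ⟩
    unit p = trans (⟨⟩-cong (f (proj₁ p)) (λ u → trans (⟨η∘ε∣⟩ (proj₂ p) (λ v → Φ (u ✶ v)))
                                                     (*-congˡ (reflexive (P.cong Φ (✶-identityʳ u))))))
                   (⟨⟩-scale (f (proj₁ p)) (ε (proj₂ p)) Φ)

  ⋆-identityˡ : ∀ f w → IsPacked w → (η∘ε ⋆ f) w ≐ f w
  ⋆-identityˡ f w w-packed Φ =
    trans (⟨⋆∣⟩ η∘ε f w Φ) (trans (∑-cong (terms w) unit) (ε-terms-first w w-packed (λ a → ⟨ f a ∣ Φ ⟩)))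
    where
    unit : ∀ p → ⟨ η∘ε (proj₁ p) ∣ (λ u → ⟨ f (proj₂ p) ∣ (λ v → Φ (u ✶ v)) ⟩) ⟩ ≈ ε (proj₁ p) * ⟨ f (proj₂ p) ∣ Φ ⟩
    unit p = trans (⟨η∘ε∣⟩ (proj₁ p) (λ u → ⟨ f (proj₂ p) ∣ (λ v → Φ (u ✶ v)) ⟩))
                   (*-congˡ (⟨⟩-cong (f (proj₂ p)) (λ v → reflexive (P.cong Φ (✶-identityˡ v)))))

  -- ⋆ is associative: both sides sum f(a) g(b) h(c) over the same multiset
  -- of three-way terms, by coassociativity and associativity of ✶
  ⋆-assoc : ∀ f g h w → ((f ⋆ g) ⋆ h) w ≐ (f ⋆ (g ⋆ h)) w
  ⋆-assoc f g h w Φ = begin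
    ⟨ ((f ⋆ g) ⋆ h) w ∣ Φ ⟩
      ≈⟨ ⟨⋆∣⟩ (f ⋆ g) h w Φ ⟩
    ∑ (λ p → ⟨ (f ⋆ g) (proj₁ p) ∣ (λ u → ⟨ h (proj₂ p) ∣ (λ v → Φ (u ✶ v)) ⟩) ⟩) (terms w)
      ≈⟨ ∑-cong (terms w) (λ p → ⟨⋆∣⟩ f g (proj₁ p) _) ⟩
    ∑ (λ p → ∑ (λ q → Θˡ (proj₁ q , (proj₂ q , proj₂ p))) (terms (proj₁ p))) (terms w)
      ≈⟨ ∑-cong (terms w) (λ p → sym (∑-map Θˡ _ (terms (proj₁ p)))) ⟩
    ∑ (λ p → ∑ Θˡ (map (λ q → (proj₁ q , (proj₂ q , proj₂ p))) (terms (proj₁ p)))) (terms w)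
      ≈⟨ sym (∑-concatMap Θˡ _ (terms w)) ⟩
    ∑ Θˡ (termsˡ w)
      ≈⟨ ∑-↭ Θˡ (termsˡ↭termsʳ w) ⟩
    ∑ Θˡ (termsʳ w)
      ≈⟨ ∑-concatMap Θˡ _ (terms w) ⟩
    ∑ (λ p → ∑ Θˡ (map (λ q → (proj₁ p , q)) (terms (proj₂ p)))) (terms w)
      ≈⟨ ∑-cong (terms w) (λ p → ∑-map Θˡ _ (terms (proj₂ p))) ⟩
    ∑ (λ p → ∑ (λ q → Θˡ (proj₁ p , q)) (terms (proj₂ p))) (terms w)
      ≈⟨ ∑-cong (terms w) (λ p → ∑-cong (terms (proj₂ p)) (λ q → reassociate (proj₁ p) (proj₁ q) (proj₂ q))) ⟩
    ∑ (λ p → ∑ (λ q → ⟨ f (proj₁ p) ∣ (λ u → Θʳ u q) ⟩) (terms (proj₂ p))) (terms w)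
      ≈⟨ ∑-cong (terms w) (λ p → sym (⟨⟩-∑ (f (proj₁ p)) Θʳ (terms (proj₂ p)))) ⟩
    ∑ (λ p → ⟨ f (proj₁ p) ∣ (λ u → ∑ (Θʳ u) (terms (proj₂ p))) ⟩) (terms w)
      ≈⟨ ∑-cong (terms w) (λ p → ⟨⟩-cong (f (proj₁ p)) (λ u → sym (⟨⋆∣⟩ g h (proj₂ p) _))) ⟩
    ∑ (λ p → ⟨ f (proj₁ p) ∣ (λ u → ⟨ (g ⋆ h) (proj₂ p) ∣ (λ v → Φ (u ✶ v)) ⟩) ⟩) (terms w)
      ≈⟨ sym (⟨⋆∣⟩ f (g ⋆ h) w Φ) ⟩
    ⟨ (f ⋆ (g ⋆ h)) w ∣ Φ ⟩ ∎
    where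
    Θˡ : Split₃ → Carrier
    Θˡ (a , (b , c)) = ⟨ f a ∣ (λ u₁ → ⟨ g b ∣ (λ u₂ → ⟨ h c ∣ (λ v → Φ ((u₁ ✶ u₂) ✶ v)) ⟩) ⟩) ⟩
    Θʳ : Word → Split → Carrier
    Θʳ u (b , c) = ⟨ g b ∣ (λ u₂ → ⟨ h c ∣ (λ v → Φ (u ✶ (u₂ ✶ v))) ⟩) ⟩
    reassociate : ∀ a b c → Θˡ (a , (b , c)) ≈ ⟨ f a ∣ (λ u → Θʳ u (b , c)) ⟩
    reassociate a b c = ⟨⟩-cong (f a) (λ u → ⟨⟩-cong (g b) (λ u₂ → ⟨⟩-cong (h c) (λ v →
      reflexive (P.cong Φ (✶-assoc u u₂ v)))))

  ⋆-cong : ∀ f f' g g' → (∀ a → IsPacked a → f a ≐ f' a) → (∀ b → IsPacked b → g b ≐ g' b) →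
           ∀ w → (f ⋆ g) w ≐ (f' ⋆ g') w
  ⋆-cong f f' g g' f≐f' g≐g' w Φ =
    trans (⟨⋆∣⟩ f g w Φ) (trans (∑-cong-All (λ {p} → both {p}) (terms-packed w)) (sym (⟨⋆∣⟩ f' g' w Φ)))
    where
    both : ∀ {p} → IsPacked (proj₁ p) × IsPacked (proj₂ p) →
           ⟨ f (proj₁ p) ∣ (λ u → ⟨ g (proj₂ p) ∣ (λ v → Φ (u ✶ v)) ⟩) ⟩ ≈
           ⟨ f' (proj₁ p) ∣ (λ u → ⟨ g' (proj₂ p) ∣ (λ v → Φ (u ✶ v)) ⟩) ⟩
    both {a , b} (a-packed , b-packed) = trans (f≐f' a a-packed _) (⟨⟩-cong (f' a) (λ u → g≐g' b b-packed _))

  InH-· : ∀ a x → InH x → InH (a · x)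
  InH-· a []      []         = []
  InH-· a (_ ∷ x) (px ∷ pxs) = px ∷ InH-· a x pxs

  InH-linExt : ∀ {A : Set} {Q : A → Set} (f : A → Lin Word) (x : Lin A) →
               All (Q ∘ proj₂) x → (∀ {a} → Q a → InH (f a)) → InH (linExt f x)
  InH-linExt f x qx h = Lists.All-concatMap (λ {p} q → InH-· (proj₁ p) (f (proj₂ p)) (h q)) qx

  InH-mul : ∀ x y → InH x → InH y → InH (mul x y)
  InH-mul x y hx hy = InH-linExt _ x hx (λ {u} pu → InH-linExt _ y hy (λ {v} pv → ✶-packed u v pu pv ∷ []))

  Δ-All : ∀ {Q : Split → Set} w → All Q (terms w) → All (Q ∘ proj₂) (Δ w)
  Δ-All {Q} w h = P.subst (All (Q ∘ proj₂)) (P.sym (Δ≡terms w)) (All.map⁺ h)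

  Δ-packed : ∀ w → InH⊗H (Δ w)
  Δ-packed w = Δ-All w (terms-packed w)

  linExt-cong-All : ∀ {A B : Set} {Q : A → Set} {f g : A → Lin B} (x : Lin A) →
                    All (Q ∘ proj₂) x → (∀ {a} → Q a → f a P.≡ g a) → linExt f x P.≡ linExt g x
  linExt-cong-All x qx f≡g = Lists.concatMap-cong-All (λ {p} q → P.cong (proj₁ p ·_) (f≡g q)) qx

  guard : Word → Lin Word → Lin Word
  guard []      X = []
  guard (_ ∷ _) X = X

  ⟨⟩-guard : ∀ b X Φ → ⟨ X ∣ Φ ⟩ ≈ ε b * ⟨ X ∣ Φ ⟩ + ⟨ guard b X ∣ Φ ⟩
  ⟨⟩-guard []      X Φ = sym (trans (+-identityʳ _) (*-identityˡ _))
  ⟨⟩-guard (_ ∷ _) X Φ = sym (trans (+-congʳ (zeroˡ _)) (+-identityˡ _))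

  InH-guard : ∀ b X → InH X → InH (guard b X)
  InH-guard []      X hX = []
  InH-guard (_ ∷ _) X hX = hX

  -1*x+x≈0 : ∀ x → - 1# * x + x ≈ 0#
  -1*x+x≈0 x = trans (+-congʳ (-1*x≈-x x)) (-‿inverseˡ x)

  -- For S ⋆ id = η∘ε the terms of Δ(w)
  -- contribute S(p₁) * p₂: S is applied to the first part and the second is
  -- glued on the right; for id ⋆ S = η∘ε the roles are exchanged.
  record Side : Set (c ⊔ ℓ) where
    field
      recursive fixed : Split → Word
      glue            : Lin Word → Word → Lin Word
      glue-unit       : ∀ X Φ → ⟨ glue X [] ∣ Φ ⟩ ≈ ⟨ X ∣ Φ ⟩
      glue-packed     : ∀ X f → InH X → IsPacked f → InH (glue X f)
      ε-terms-fixed   : ∀ w → IsPacked w → ∀ (H : Word → Carrier) →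
                        ∑ (λ p → ε (fixed p) * H (recursive p)) (terms w) ≈ H w
      parts           : ∀ p → (recursive p P.≡ proj₁ p × fixed p P.≡ proj₂ p)
                            ⊎ (recursive p P.≡ proj₂ p × fixed p P.≡ proj₁ p)

  -- The antipode on a side, defined by S(1) = 1 and, for w ≠ 1,
  -- S(w) = - Σ' glue (S(recursive p)) (fixed p) over the terms p of Δ(w) with
  -- nonempty fixed part (so recursive p is shorter than w).  Recursion is on
  -- a fuel bound for the length.
  module OnSide (σ : Side) where
    open Side σ

    length-parts : ∀ p → length (recursive p) +ℕ length (fixed p) P.≡ length (proj₁ p) +ℕ length (proj₂ p)
    length-parts p with parts p
    ... | inj₁ (r≡ , f≡) = P.cong₂ (λ r f → length r +ℕ length f) r≡ f≡
    ... | inj₂ (r≡ , f≡) = P.trans (P.cong₂ (λ r f → length r +ℕ length f) r≡ f≡)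
                                   (+ℕ-comm (length (proj₂ p)) (length (proj₁ p)))

    parts-packed : ∀ p → IsPacked (proj₁ p) × IsPacked (proj₂ p) → IsPacked (recursive p) × IsPacked (fixed p)
    parts-packed p (p₁-packed , p₂-packed) with parts p
    ... | inj₁ (r≡ , f≡) = P.subst IsPacked (P.sym r≡) p₁-packed , P.subst IsPacked (P.sym f≡) p₂-packed
    ... | inj₂ (r≡ , f≡) = P.subst IsPacked (P.sym r≡) p₂-packed , P.subst IsPacked (P.sym f≡) p₁-packed

    parts-empty : recursive ([] , []) P.≡ [] × fixed ([] , []) P.≡ []
    parts-empty with parts ([] , [])
    ... | inj₁ both = both
    ... | inj₂ both = both

    convolve : (Word → Lin Word) → Word → Lin Word
    convolve S w = linExt (λ p → glue (S (recursive p)) (fixed p)) (Δ w)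

    antipodeWith : ℕ → Word → Lin Word
    antipodeWith zero    w       = ⟦ [] ⟧
    antipodeWith (suc k) []      = ⟦ [] ⟧
    antipodeWith (suc k) (x ∷ w) =
      (- 1#) · linExt (λ p → guard (fixed p) (glue (antipodeWith k (recursive p)) (fixed p))) (Δ (x ∷ w))

    antipode : Word → Lin Word
    antipode w = antipodeWith (length w) w

    shorter : ∀ {n} p y ys → fixed p P.≡ y ∷ ys →
              length (proj₁ p) +ℕ length (proj₂ p) P.≡ suc n → length (recursive p) ≤ n
    shorter {n} p y ys fixed≡ total =
      P.subst (length (recursive p) ≤_) (suc-injective (P.trans (P.sym (+-suc _ (length ys))) sum≡))
              (m≤m+n (length (recursive p)) (length ys))
      where
      sum≡ : length (recursive p) +ℕ suc (length ys) P.≡ suc n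
      sum≡ = P.trans (P.cong (λ f → length (recursive p) +ℕ length f) (P.sym fixed≡)) (P.trans (length-parts p) total)

    fuel-irrelevant : ∀ k k' w → length w ≤ k → length w ≤ k' → antipodeWith k w P.≡ antipodeWith k' w
    fuel-irrelevant zero    zero     []      _ _ = P.refl
    fuel-irrelevant zero    (suc k') []      _ _ = P.refl
    fuel-irrelevant (suc k) zero     []      _ _ = P.refl
    fuel-irrelevant (suc k) (suc k') []      _ _ = P.refl
    fuel-irrelevant (suc k) (suc k') (x ∷ w) (s≤s w≤k) (s≤s w≤k') =
      P.cong ((- 1#) ·_) (linExt-cong-All (Δ (x ∷ w)) (Δ-All (x ∷ w) (terms-length (x ∷ w))) (λ {p} → same p))
      where
      same : ∀ p → length (proj₁ p) +ℕ length (proj₂ p) P.≡ length (x ∷ w) →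
             guard (fixed p) (glue (antipodeWith k (recursive p)) (fixed p)) P.≡
             guard (fixed p) (glue (antipodeWith k' (recursive p)) (fixed p))
      same p total with fixed p in fixed≡
      ... | []     = P.refl
      ... | y ∷ ys = P.cong (λ X → glue X (y ∷ ys))
                       (fuel-irrelevant k k' (recursive p) (≤-trans short w≤k) (≤-trans short w≤k'))
        where
        short : length (recursive p) ≤ length w
        short = shorter p y ys fixed≡ total

    antipodeWith-packed : ∀ k w → IsPacked w → InH (antipodeWith k w)
    antipodeWith-packed zero    w       _        = P.refl ∷ []
    antipodeWith-packed (suc k) []      _        = P.refl ∷ []
    antipodeWith-packed (suc k) (x ∷ w) w-packed = InH-· (- 1#) _ (InH-linExt _ (Δ (x ∷ w)) (Δ-packed (x ∷ w))
      (λ {p} p-packed → InH-guard (fixed p) _ (glue-packed _ (fixed p)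
        (antipodeWith-packed k (recursive p) (proj₁ (parts-packed p p-packed))) (proj₂ (parts-packed p p-packed)))))

    antipode-packed : ∀ w → IsPacked w → InH (antipode w)
    antipode-packed w = antipodeWith-packed (length w) w

    -- ε(f) only sees glue X f when f is empty, where gluing is trivial
    ε-glue : ∀ f X Φ → ε f * ⟨ glue X f ∣ Φ ⟩ ≈ ε f * ⟨ X ∣ Φ ⟩
    ε-glue []      X Φ = *-congˡ (glue-unit X Φ)
    ε-glue (_ ∷ _) X Φ = trans (zeroˡ _) (sym (zeroˡ _))

    antipode-inverse : ∀ w → IsPacked w → convolve antipode w ≐ η∘ε w
    antipode-inverse [] _ Φ = begin
      ⟨ convolve antipode [] ∣ Φ ⟩
        ≈⟨ ⟨⟩-linExt (λ p → glue (antipode (recursive p)) (fixed p)) (Δ []) Φ ⟩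
      1# * ⟨ glue (antipode (recursive ([] , []))) (fixed ([] , [])) ∣ Φ ⟩ + 0#
        ≈⟨ trans (+-identityʳ _) (*-identityˡ _) ⟩
      ⟨ glue (antipode (recursive ([] , []))) (fixed ([] , [])) ∣ Φ ⟩
        ≡⟨ P.cong₂ (λ r f → ⟨ glue (antipode r) f ∣ Φ ⟩) (proj₁ parts-empty) (proj₂ parts-empty) ⟩
      ⟨ glue ⟦ [] ⟧ [] ∣ Φ ⟩            ≈⟨ glue-unit ⟦ [] ⟧ Φ ⟩
      ⟨ ⟦ [] ⟧ ∣ Φ ⟩                    ≈⟨ ⟨⟩-⟦⟧ [] Φ ⟩
      Φ []                              ≈⟨ sym (trans (⟨η∘ε∣⟩ [] Φ) (*-identityˡ _)) ⟩
      ⟨ η∘ε [] ∣ Φ ⟩                    ∎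
    antipode-inverse (x ∷ w) w-packed Φ = begin
      ⟨ convolve antipode W ∣ Φ ⟩
        ≈⟨ trans (⟨⟩-linExt M (Δ W) Φ) (⟨Δ∣⟩ W _) ⟩
      ∑ (λ p → ⟨ M p ∣ Φ ⟩) (terms W)
        ≈⟨ ∑-cong (terms W) (λ p → ⟨⟩-guard (fixed p) (M p) Φ) ⟩
      ∑ (λ p → ε (fixed p) * ⟨ M p ∣ Φ ⟩ + ⟨ guard (fixed p) (M p) ∣ Φ ⟩) (terms W)
        ≈⟨ ∑-+ _ _ (terms W) ⟩
      ∑ (λ p → ε (fixed p) * ⟨ M p ∣ Φ ⟩) (terms W) + ∑ (λ p → ⟨ guard (fixed p) (M p) ∣ Φ ⟩) (terms W)
        ≈⟨ +-cong (trans (∑-cong (terms W) (λ p → ε-glue (fixed p) _ Φ))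
                         (ε-terms-fixed W w-packed (λ b → ⟨ antipode b ∣ Φ ⟩)))
                  (∑-cong-All (λ {p} → reflexive ∘ P.cong ⟨_∣ Φ ⟩ ∘ refuel p) (terms-length W)) ⟩
      ⟨ antipode W ∣ Φ ⟩ + ∑ (λ p → ⟨ Z p ∣ Φ ⟩) (terms W)
        ≈⟨ +-cong (⟨⟩-· (- 1#) (linExt Z (Δ W)) Φ) (sym (trans (⟨⟩-linExt Z (Δ W) Φ) (⟨Δ∣⟩ W _))) ⟩
      - 1# * ⟨ linExt Z (Δ W) ∣ Φ ⟩ + ⟨ linExt Z (Δ W) ∣ Φ ⟩
        ≈⟨ -1*x+x≈0 _ ⟩
      0#
        ≈⟨ sym (trans (⟨η∘ε∣⟩ W Φ) (zeroˡ _)) ⟩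
      ⟨ η∘ε W ∣ Φ ⟩ ∎
      where
      W : Word
      W = x ∷ w
      -- the terms of S ⋆ id, and those of the recursion defining S(W)
      M Z : Split → Lin Word
      M p = glue (antipode (recursive p)) (fixed p)
      Z p = guard (fixed p) (glue (antipodeWith (length w) (recursive p)) (fixed p))
      refuel : ∀ p → length (proj₁ p) +ℕ length (proj₂ p) P.≡ length W → guard (fixed p) (M p) P.≡ Z p
      refuel p total with fixed p in fixed≡
      ... | []     = P.refl
      ... | y ∷ ys = P.cong (λ X → glue X (y ∷ ys))
                       (fuel-irrelevant _ (length w) (recursive p) ≤-refl (shorter p y ys fixed≡ total))

  leftSide : Side
  leftSide = record
    { recursive     = proj₁
    ; fixed         = proj₂
    ; glue          = λ X b → mul X ⟦ b ⟧
    ; glue-unit     = λ X Φ → trans (⟨⟩-mul X ⟦ [] ⟧ Φ) (⟨⟩-cong X (λ u →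
                        trans (⟨⟩-⟦⟧ [] (λ v → Φ (u ✶ v))) (reflexive (P.cong Φ (✶-identityʳ u)))))
    ; glue-packed   = λ X b X-packed b-packed → InH-mul X ⟦ b ⟧ X-packed (b-packed ∷ [])
    ; ε-terms-fixed = ε-terms-second
    ; parts         = λ p → inj₁ (P.refl , P.refl)
    }

  rightSide : Side
  rightSide = record
    { recursive     = proj₂
    ; fixed         = proj₁
    ; glue          = λ X a → mul ⟦ a ⟧ X
    ; glue-unit     = λ X Φ → trans (⟨⟩-mul ⟦ [] ⟧ X Φ) (trans (⟨⟩-⟦⟧ [] (λ u → ⟨ X ∣ (λ v → Φ (u ✶ v)) ⟩))
                        (⟨⟩-cong X (λ v → reflexive (P.cong Φ (✶-identityˡ v)))))
    ; glue-packed   = λ X a X-packed a-packed → InH-mul ⟦ a ⟧ X (a-packed ∷ []) X-packed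
    ; ε-terms-fixed = ε-terms-first
    ; parts         = λ p → inj₂ (P.refl , P.refl)
    }

  S S' : Word → Lin Word
  S  = OnSide.antipode leftSide
  S' = OnSide.antipode rightSide

  S-packed : ∀ w → IsPacked w → InH (S w)
  S-packed = OnSide.antipode-packed leftSide

  S⋆id : ∀ w → IsPacked w → (S ⋆ ⟦_⟧) w ≐ η∘ε w
  S⋆id = OnSide.antipode-inverse leftSide

  id⋆S' : ∀ w → IsPacked w → (⟦_⟧ ⋆ S') w ≐ η∘ε w
  id⋆S' = OnSide.antipode-inverse rightSide

  -- a left and a right inverse in the convolution monoid coincide:
  -- S = S ⋆ (id ⋆ S') = (S ⋆ id) ⋆ S' = S'
  S≐S' : ∀ w → IsPacked w → S w ≐ S' w
  S≐S' w w-packed Φ = begin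
    ⟨ S w ∣ Φ ⟩                   ≈⟨ sym (⋆-identityʳ S w w-packed Φ) ⟩
    ⟨ (S ⋆ η∘ε) w ∣ Φ ⟩           ≈⟨ ⋆-cong S S η∘ε (⟦_⟧ ⋆ S') (λ _ _ _ → refl)
                                              (λ b b-packed Ψ → sym (id⋆S' b b-packed Ψ)) w Φ ⟩
    ⟨ (S ⋆ (⟦_⟧ ⋆ S')) w ∣ Φ ⟩    ≈⟨ sym (⋆-assoc S ⟦_⟧ S' w Φ) ⟩
    ⟨ ((S ⋆ ⟦_⟧) ⋆ S') w ∣ Φ ⟩    ≈⟨ ⋆-cong (S ⋆ ⟦_⟧) η∘ε S' S' S⋆id (λ _ _ _ → refl) w Φ ⟩
    ⟨ (η∘ε ⋆ S') w ∣ Φ ⟩          ≈⟨ ⋆-identityˡ S' w w-packed Φ ⟩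
    ⟨ S' w ∣ Φ ⟩                  ∎

  id⋆S : ∀ w → IsPacked w → (⟦_⟧ ⋆ S) w ≐ η∘ε w
  id⋆S w w-packed Φ = trans (⋆-cong ⟦_⟧ ⟦_⟧ S S' (λ _ _ _ → refl) S≐S' w Φ) (id⋆S' w w-packed Φ)


mainTheorem1 : ∀ {c ℓ : Level} (K : Field c ℓ) → Hopf.IsPackedWordHopfAlgebra K
mainTheorem1 K = record
  { unit-packed  = P.refl
  ; mul-closed   = ✶-packed
  ; Δ-closed     = λ w _ → Δ-packed w
  ; mul-assoc    = λ u v w _ _ _ → ✶-assoc u v w
  ; mul-unitˡ    = λ u _ → ✶-identityˡ u
  ; mul-unitʳ    = λ u _ → ✶-identityʳ u
  ; coassoc      = λ w _ → ≐⇒LinEq _≟3_ (Δ⊗id (Δ w)) (id⊗Δ (Δ w)) (coassociative w)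
  ; counitˡ      = λ w w-packed → ≐⇒LinEq _≟W_ (ε⊗id (Δ w)) ⟦ w ⟧ (counit-left w w-packed)
  ; counitʳ      = λ w w-packed → ≐⇒LinEq _≟W_ (id⊗ε (Δ w)) ⟦ w ⟧ (counit-right w w-packed)
  ; Δ-mul        = λ u v _ _ → ≐⇒LinEq _≟2_ (Δ (u ✶ v)) (mul⊗ (Δ u) (Δ v)) (Δ-multiplicative u v)
  ; Δ-unit       = λ _ → refl
  ; ε-mul        = λ u v _ _ → ε-multiplicative u v
  ; ε-unit       = refl
  ; antipode     = S , S-packed , (λ w w-packed → ≐⇒LinEq _≟W_ ((S ⋆ ⟦_⟧) w) (η∘ε w) (S⋆id w w-packed))
                                , (λ w w-packed → ≐⇒LinEq _≟W_ ((⟦_⟧ ⋆ S) w) (η∘ε w) (id⋆S w w-packed))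
  }
  where
  open Field K using (refl)
  open Hopf K
  open Linear K using (≐⇒LinEq)
  open Bialgebra K
  open Antipode K
  open Words using (✶-packed; ✶-assoc; ✶-identityˡ; ✶-identityʳ)
  open import Data.Product using (_,_)
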